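{- Let $n\ge1$, let $\mathcal T$ be a tree sequence of order $n$ and $i\in\{1,\dots,n\}$. Then $\Delta_{k_i}^n L_n(\mathcal T,\mathbf k)=0$ for all $\mathbf k=(k_1,\dots,k_n)\in\mathbb Z^n$.
   Context: $\Delta_{k_i}$ is the forward difference operator in the variable $k_i$: $\Delta_{k_i}f(k_1,\dots,k_n)=f(k_1,\dots,k_i+1,\dots,k_n)-f(k_1,\dots,k_n)$. An $n$-tree is a directed tree with vertex set $\{1,\dots,n\}$ whose $n-1$ edges are named bijectively $1',\dots,(n-1)'$. A tree sequence of order $n$ is $\mathcal T=(T_1,\dots,T_n)$ with $T_i$ an $i$-tree. For an $n$-tree $T$ and $\mathbf k\in\mathbb Z^n$, $\mathbf l\in\mathbb Z^{n-1}$ is admissible for $(T,\mathbf k)$ if for every edge $j'$ directed from $p$ to $q$: if $k_p+p<k_q+q$ then $k_p+p\le l_j+j<k_q+q$, otherwise $k_q+q\le l_j+j<k_p+p$, in which case $j'$ is an inversion of $(T,\mathbf k)$. A Gelfand–Tsetlin tree sequence for $\mathcal T$ and $\mathbf k$ is $\mathbf L=(\mathbf l_1,\dots,\mathbf l_n)$, $\mathbf l_i\in\mathbb Z^i$, $\mathbf l_n=\mathbf k$, with $\mathbf l_{i-1}$ admissible for $(T_i,\mathbf l_i)$ for $2\le i\le n$; its inversions are those of the pairs $(T_i,\mathbf l_i)$. Sign of an $n$-tree $T$: pick a root $r$, orient all edges away from $r$ (standard orientation), call an edge reversed if its orientation in $T$ differs; let $\pi$ be the permutation consisting of $r$ followed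 by the heads (w.r.t. standard orientation) of $1',\dots,(n-1)'$ in order; $\operatorname{sgn}T=(-1)^{\#\text{reversed}}\operatorname{sgn}\pi$ (root-independent). $\operatorname{sgn}\mathcal T=\prod_i\operatorname{sgn}T_i$; $\operatorname{sgn}\mathbf L=(-1)^{\#\text{inversions of }\mathbf L}\operatorname{sgn}\mathcal T$; $L_n(\mathcal T,\mathbf k)=\sum_{\mathbf L}\operatorname{sgn}\mathbf L$ over all Gelfand–Tsetlin tree sequences for $\mathcal T,\mathbf k$. -}

module Defs where

open import Data.Nat as ℕ using (ℕ; zero; suc)
open import Data.Nat.Properties using () renaming (_<?_ to _<ℕ?_)
open import Data.Integer as ℤ using (ℤ; +_; -[1+_]; _+_; _-_; _*_; _≤_; _<_; _⊓_; _⊔_; 0ℤ; 1ℤ; -1ℤ)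
open import Data.Integer.Properties using (_≤?_; _<?_)
open import Data.Fin as Fin using (Fin; zero; suc; toℕ)
open import Data.Fin.Properties using (all?) renaming (_≟_ to _≟ᶠ_)
open import Data.Bool using (Bool; true; false; if_then_else_; _∧_)
open import Data.List using (List; []; _∷_; map; concatMap; filter; upTo; allFin; foldr)
open import Data.Product using (_×_; _,_; proj₁; proj₂)
open import Data.Unit using (⊤; tt)
open import Data.Vec.Functional using (Vector; updateAt) renaming (_∷_ to _∷ᶠ_)
import Relation.Binary.PropositionalEquality as Eq
open import Relation.Nullary using (¬_; Dec; does; ¬?; _×-dec_; _→-dec_)

-- Conventions: an (m+1)-tree has vertices Fin (suc m), vertex v ∈ Fin
-- standing for the paper's vertex toℕ v + 1, and m edges Fin m, edge
-- j ∈ Fin m standing for the paper's edge (toℕ j + 1)'.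
-- edge j = (p , q) means j' is directed from p to q.

data Conn {m : ℕ} (E : Fin m → Fin (suc m) × Fin (suc m))
          (u : Fin (suc m)) : Fin (suc m) → Set where
  here : Conn E u u
  fwd  : ∀ j → Conn E u (proj₁ (E j)) → Conn E u (proj₂ (E j))
  bwd  : ∀ j → Conn E u (proj₂ (E j)) → Conn E u (proj₁ (E j))

-- A directed tree on m+1 vertices with m named edges:
-- m edges and connected underlying graph (equivalently: a tree).
record Tree (m : ℕ) : Set where
  field
    edge      : Fin m → Fin (suc m) × Fin (suc m)
    connected : ∀ v → Conn edge zero v
open Tree public

-- tree sequence of order n: (T_1, ..., T_n), T_i an i-tree (= Tree (i-1))
TreeSeq : ℕ → Set
TreeSeq zero    = ⊤
TreeSeq (suc n) = TreeSeq n × Tree n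

negPow : ℕ → ℤ
negPow zero          = 1ℤ
negPow (suc zero)    = -1ℤ
negPow (suc (suc n)) = negPow n

count : ∀ {m} → (Fin m → Bool) → ℕ
count {m} p = foldr (λ j acc → if p j then suc acc else acc) 0 (allFin m)

iter : ∀ {A : Set} → ℕ → (A → A) → A → A
iter zero    f x = x
iter (suc r) f x = f (iter r f x)

-- graph distances from the root (vertex 1 = zero), by m rounds of
-- relaxation (vertices not yet reached carry the value m+1)
dist : ∀ {m} → Tree m → Fin (suc m) → ℕ
dist {m} T = iter m step init
  where
  init : Fin (suc m) → ℕ
  init zero    = 0
  init (suc _) = suc m
  step : (Fin (suc m) → ℕ) → Fin (suc m) → ℕ
  step d v = foldr ℕ._⊓_ (d v) (map relax (allFin m))
    where
    relax : Fin m → ℕ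
    relax j with edge T j
    ... | (p , q) = if does (v ≟ᶠ q) then suc (d p)
                    else if does (v ≟ᶠ p) then suc (d q) else d v

-- standard orientation with root 1: edge j is oriented away from the root
-- head of edge j w.r.t. the standard orientation
stdHead : ∀ {m} → Tree m → Fin m → Fin (suc m)
stdHead T j with edge T j
... | (p , q) = if does (dist T p <ℕ? dist T q) then q else p

reversed : ∀ {m} → Tree m → Fin m → Bool
reversed T j with edge T j
... | (p , q) = if does (dist T p <ℕ? dist T q) then false else true

πT : ∀ {m} → Tree m → Fin (suc m) → Fin (suc m)
πT T zero    = zero
πT T (suc j) = stdHead T j

permSign : ∀ {k} → (Fin k → Fin k) → ℤ
permSign {k} π = negPow (foldr ℕ._+_ 0 (map (λ a → count (λ b →
    does (toℕ a <ℕ? toℕ b) ∧ does (toℕ (π b) <ℕ? toℕ (π a)))) (allFin k)))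

sgnTree : ∀ {m} → Tree m → ℤ
sgnTree T = negPow (count (reversed T)) * permSign (πT T)

-- k_p + p  (1-based p)
vval : ∀ {m} → (Fin (suc m) → ℤ) → Fin (suc m) → ℤ
vval k p = k p + + suc (toℕ p)

-- l_j + j  (1-based j)
eval : ∀ {m} → (Fin m → ℤ) → Fin m → ℤ
eval l j = l j + + suc (toℕ j)

EdgeAdm : ∀ {m} → Tree m → (Fin (suc m) → ℤ) → (Fin m → ℤ) → Fin m → Set
EdgeAdm T k l j =
  (a < b → (a ≤ x × x < b)) × (¬ (a < b) → (b ≤ x × x < a))
  where
  a = vval k (proj₁ (edge T j))
  b = vval k (proj₂ (edge T j))
  x = eval l j

Admissible : ∀ {m} → Tree m → (Fin (suc m) → ℤ) → (Fin m → ℤ) → Set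
Admissible T k l = ∀ j → EdgeAdm T k l j

admissible? : ∀ {m} (T : Tree m) (k : Fin (suc m) → ℤ) (l : Fin m → ℤ) →
              Dec (Admissible T k l)
admissible? T k l = all? λ j →
  let a = vval k (proj₁ (edge T j))
      b = vval k (proj₂ (edge T j))
      x = eval l j in
  ((a <? b) →-dec ((a ≤? x) ×-dec (x <? b))) ×-dec
  (¬? (a <? b) →-dec ((b ≤? x) ×-dec (x <? a)))

invCount : ∀ {m} → Tree m → (Fin (suc m) → ℤ) → ℕ
invCount T k = count λ j →
  if does (vval k (proj₁ (edge T j)) <? vval k (proj₂ (edge T j)))
  then false else true

-- finite enumeration of candidates (a box containing all admissible l)

span : ℤ → ℕ
span (+ n)    = n
span -[1+ _ ] = 0

-- integers in [lo, hi)
range : ℤ → ℤ → List ℤ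
range lo hi = map (λ t → lo + + t) (upTo (span (hi - lo)))

box : ∀ m → (Fin m → ℤ) → (Fin m → ℤ) → List (Fin m → ℤ)
box zero    lo hi = (λ ()) ∷ []
box (suc m) lo hi = concatMap (λ x → map (λ r → x ∷ᶠ r)
                      (box m (λ j → lo (suc j)) (λ j → hi (suc j))))
                    (range (lo zero) (hi zero))

candidates : ∀ {m} → Tree m → (Fin (suc m) → ℤ) → List (Fin m → ℤ)
candidates {m} T k = box m lo hi
  where
  lo hi : Fin m → ℤ
  lo j = (vval k (proj₁ (edge T j)) ⊓ vval k (proj₂ (edge T j))) - + suc (toℕ j)
  hi j = (vval k (proj₁ (edge T j)) ⊔ vval k (proj₂ (edge T j))) - + suc (toℕ j)

admissibles : ∀ {m} → Tree m → (Fin (suc m) → ℤ) → List (Fin m → ℤ)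
admissibles T k = filter (admissible? T k) (candidates T k)

Seq : ℕ → Set
Seq zero    = ⊤
Seq (suc n) = Seq n × (Fin (suc n) → ℤ)

top : ∀ {n} → Seq (suc n) → Fin (suc n) → ℤ
top (_ , k) = k

IsGT : ∀ n → TreeSeq (suc n) → (Fin (suc n) → ℤ) → Seq (suc n) → Set
IsGT zero    _        k (_ , l) = l Eq.≡ k
IsGT (suc n) (ts , T) k (s , l) = (l Eq.≡ k) × Admissible T l (top s) × IsGT n ts (top s) s

gtSeqs : ∀ n → TreeSeq (suc n) → (Fin (suc n) → ℤ) → List (Seq (suc n))
gtSeqs zero    _        k = (tt , k) ∷ []
gtSeqs (suc n) (ts , T) k =
  map (λ s → s , k) (concatMap (gtSeqs n ts) (admissibles T k))

sgnTS : ∀ n → TreeSeq n → ℤ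
sgnTS zero    _        = 1ℤ
sgnTS (suc n) (ts , T) = sgnTS n ts * sgnTree T

invSeq : ∀ n → TreeSeq n → Seq n → ℕ
invSeq zero    _        _       = 0
invSeq (suc n) (ts , T) (s , l) = invSeq n ts s ℕ.+ invCount T l

sgnGT : ∀ n → TreeSeq n → Seq n → ℤ
sgnGT n ts s = negPow (invSeq n ts s) * sgnTS n ts

sumℤ : List ℤ → ℤ
sumℤ = foldr _+_ 0ℤ

-- L_{n+1}(𝒯, k)
Lpoly : ∀ n → TreeSeq (suc n) → (Fin (suc n) → ℤ) → ℤ
Lpoly n ts k = sumℤ (map (sgnGT (suc n) ts) (gtSeqs n ts k))

Δ : ∀ {n} → Fin n → ((Fin n → ℤ) → ℤ) → (Fin n → ℤ) → ℤ
Δ i f k = f (updateAt k i (λ x → x + 1ℤ)) - f k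

Δ^ : ∀ {n} → ℕ → Fin n → ((Fin n → ℤ) → ℤ) → (Fin n → ℤ) → ℤ
Δ^ r i f = iter r (Δ i) f

-- Write y = (k₁ + 1, …, kₙ₊₁ + n + 1). By induction along the tree sequence, L is a constant
-- multiple of V n y, where V 0 = 1 and V (n+1) y = Σᵣ (-1)ʳ ∫V n (y without yᵣ), ∫V n z being the
-- iterated indefinite sum of V n over the box [0, z). Indeed, shifted by (1, …, n), the l admissible
-- for (T, k) fill the box between the values of y at the tails and at the heads of the edges, and the
-- inversion sign turns their sum into the oriented box sum. By inclusion–exclusion this is a signed
-- sum, over the choices of one endpoint per edge, of the alternating function ∫V n at the chosen
-- values. Expanding along the vertex r left out, the coefficient of (-1)ʳ ∫V n (y without yᵣ) is the
-- same at both ends of every edge (flipping the choice at that edge trades one end for the other),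
-- hence constant on the connected tree. Each indefinite summation raises the degree in every variable
-- by one, so V n has degree n in each variable and is killed by n + 1 differences.

module Submission where

open import Defs
import Algebra.Properties.CommutativeMonoid.Sum as CMSum
open import Data.Bool using (Bool; true; false; if_then_else_; not)
open import Data.Empty using (⊥-elim)
open import Data.Fin using (Fin; zero; suc; toℕ; inject₁; punchIn; punchOut)
open import Data.Fin.Permutation using (Permutation; permutation)
open import Data.Fin.Properties as FinP
  using (toℕ-injective; toℕ-inject₁; suc-injective; punchIn-injective; punchIn-punchOut; punchInᵢ≢i; punchIn-mono-≤; any?)
open import Data.Integer as ℤ using (ℤ; -[1+_]; _+_; _-_; _*_; -_; _⊓_; _⊔_; 0ℤ; 1ℤ; -1ℤ)
import Data.Integer.Properties as ℤP
open import Data.Integer.Tactic.RingSolver using (solve-∀)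
open import Data.List as List using (List; []; _∷_; map; concatMap; applyUpTo; upTo; _++_)
open import Data.Nat as ℕ using (ℕ; zero; suc; z≤n; s≤s)
import Data.Nat.Properties as ℕP
import Data.List.Properties as ListP
open import Data.List.Relation.Unary.All as All using (All; []; _∷_)
import Data.List.Relation.Unary.All.Properties as AllP
open import Data.Product using (∃; _×_; _,_; proj₁; proj₂)
open import Data.Vec.Functional using (updateAt; tail) renaming (_∷_ to _∷ᶠ_)
open import Data.Vec.Functional.Properties
  using (updateAt-updates; updateAt-minimal; updateAt-id-local; updateAt-updateAt; map-updateAt-local)
open import Function using (_∘_)
open import Relation.Binary.PropositionalEquality
open import Relation.Nullary using (¬_; yes; no; does)
open import Relation.Nullary.Decidable using (dec-true; dec-false)

open ℤP using (*-zeroʳ; *-zeroˡ; *-identityˡ; *-identityʳ; -1*i≡-i; +-identityʳ; +-identityˡ)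
open import Algebra.Properties.CommutativeSemigroup ℤP.+-commutativeSemigroup
  using () renaming (interchange to +-interchange)
open import Algebra.Properties.CommutativeSemigroup ℕP.+-commutativeSemigroup
  using () renaming (x∙yz≈y∙xz to ℕ-+-left-comm)
open import Algebra.Properties.Semiring.Sum ℤP.+-*-semiring
  using (sum; sum-cong-≗; ∑-distrib-+; *-distribˡ-sum; sum-permute; sum-replicate-zero)

module Product = CMSum ℤP.*-1-commutativeMonoid
module Sumℕ = CMSum ℕP.+-0-commutativeMonoid

∏ : ∀ {n} → (Fin n → ℤ) → ℤ
∏ = Product.sum

swap : ∀ {m} → Fin m → Fin (suc m) → Fin (suc m)
swap zero    zero          = suc zero
swap zero    (suc zero)    = zero
swap zero    (suc (suc t)) = suc (suc t)
swap (suc k) zero          = zero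
swap (suc k) (suc t)       = suc (swap k t)

swap-involutive : ∀ {m} (k : Fin m) t → swap k (swap k t) ≡ t
swap-involutive zero    zero          = refl
swap-involutive zero    (suc zero)    = refl
swap-involutive zero    (suc (suc t)) = refl
swap-involutive (suc k) zero          = refl
swap-involutive (suc k) (suc t)       = cong suc (swap-involutive k t)

swap-inject₁ : ∀ {m} (k : Fin m) → swap k (inject₁ k) ≡ suc k
swap-inject₁ zero    = refl
swap-inject₁ (suc k) = cong suc (swap-inject₁ k)

swap-suc : ∀ {m} (k : Fin m) → swap k (suc k) ≡ inject₁ k
swap-suc zero    = refl
swap-suc (suc k) = cong suc (swap-suc k)

swap-other : ∀ {m} (k : Fin m) t → t ≢ inject₁ k → t ≢ suc k → swap k t ≡ t
swap-other zero    zero          t≢k _   = ⊥-elim (t≢k refl)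
swap-other zero    (suc zero)    _   t≢k = ⊥-elim (t≢k refl)
swap-other zero    (suc (suc t)) _   _   = refl
swap-other (suc k) zero          _   _   = refl
swap-other (suc k) (suc t)       t≢k t≢k′ =
  cong suc (swap-other k t (t≢k ∘ cong suc) (t≢k′ ∘ cong suc))

swapPermutation : ∀ {m} → Fin m → Permutation (suc m) (suc m)
swapPermutation k = permutation (swap k) (swap k) (swap-involutive k) (swap-involutive k)

sum-swap : ∀ {m} (k : Fin m) (f : Fin (suc m) → ℤ) → sum (f ∘ swap k) ≡ sum f
sum-swap k f = sym (sum-permute f (swapPermutation k))

sum-zero : ∀ n {f : Fin n → ℤ} → (∀ i → f i ≡ 0ℤ) → sum f ≡ 0ℤ
sum-zero n f≡0 = trans (sum-cong-≗ f≡0) (sum-replicate-zero n)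

sum-single : ∀ {n} (f : Fin n → ℤ) i → (∀ j → j ≢ i → f j ≡ 0ℤ) → sum f ≡ f i
sum-single f zero    f≡0 =
  trans (cong (f zero +_) (sum-zero _ (λ j → f≡0 (suc j) λ ()))) (+-identityʳ _)
sum-single f (suc i) f≡0 =
  trans (cong (_+ sum (tail f)) (f≡0 zero λ ()))
        (trans (+-identityˡ _) (sum-single (tail f) i (λ j j≢i → f≡0 (suc j) (j≢i ∘ suc-injective))))

_[_]≔_ : ∀ {A : Set} {m} → (Fin m → A) → Fin m → A → Fin m → A
z [ i ]≔ t = updateAt z i (λ _ → t)

∷-cong : ∀ {A : Set} {m} (x : A) {u v : Fin m → A} → u ≗ v → (x ∷ᶠ u) ≗ (x ∷ᶠ v)
∷-cong x u≗v zero    = refl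
∷-cong x u≗v (suc j) = u≗v j

∏-zero : ∀ {n} (f : Fin n → ℤ) j → f j ≡ 0ℤ → ∏ f ≡ 0ℤ
∏-zero f zero    f≡0 = cong (_* ∏ (tail f)) f≡0
∏-zero f (suc j) f≡0 = trans (cong (f zero *_) (∏-zero (tail f) j f≡0)) (*-zeroʳ (f zero))

∏-one : ∀ {n} (f : Fin n → ℤ) → (∀ i → f i ≡ 1ℤ) → ∏ f ≡ 1ℤ
∏-one {zero}  f f≡1 = refl
∏-one {suc n} f f≡1 = cong₂ _*_ (f≡1 zero) (∏-one (tail f) (f≡1 ∘ suc))

∏-update : ∀ {n} (f : Fin n → ℤ) j x → ∏ (f [ j ]≔ x) * f j ≡ ∏ f * x
∏-update f zero    x = rearrange x (∏ (tail f)) (f zero)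
  where
  rearrange : ∀ a p b → a * p * b ≡ b * p * a
  rearrange = solve-∀
∏-update f (suc j) x = begin
  f zero * ∏ (tail f [ j ]≔ x) * f (suc j) ≡⟨ ℤP.*-assoc (f zero) _ _ ⟩
  f zero * (∏ (tail f [ j ]≔ x) * f (suc j)) ≡⟨ cong (f zero *_) (∏-update (tail f) j x) ⟩
  f zero * (∏ (tail f) * x)                  ≡⟨ ℤP.*-assoc (f zero) _ x ⟨
  f zero * ∏ (tail f) * x ∎
  where open ≡-Reasoning

Extensional : ∀ {A : Set} {m} → ((Fin m → A) → ℤ) → Set
Extensional F = ∀ {u v} → u ≗ v → F u ≡ F v

sumCube : ∀ m → ((Fin m → Bool) → ℤ) → ℤ
sumCube zero    Φ = Φ (λ ())
sumCube (suc m) Φ = sumCube m (Φ ∘ (true ∷ᶠ_)) + sumCube m (Φ ∘ (false ∷ᶠ_))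

sumCube-cong : ∀ m {Φ Ψ : (Fin m → Bool) → ℤ} → (∀ c → Φ c ≡ Ψ c) → sumCube m Φ ≡ sumCube m Ψ
sumCube-cong zero    Φ≡Ψ = Φ≡Ψ _
sumCube-cong (suc m) Φ≡Ψ = cong₂ _+_ (sumCube-cong m (Φ≡Ψ ∘ _)) (sumCube-cong m (Φ≡Ψ ∘ _))

*-distribˡ-sumCube : ∀ m x (Φ : (Fin m → Bool) → ℤ) → x * sumCube m Φ ≡ sumCube m (λ c → x * Φ c)
*-distribˡ-sumCube zero    x Φ = refl
*-distribˡ-sumCube (suc m) x Φ = trans (ℤP.*-distribˡ-+ x _ _)
  (cong₂ _+_ (*-distribˡ-sumCube m x _) (*-distribˡ-sumCube m x _))

sumCube-flip : ∀ m (j : Fin m) {Φ : (Fin m → Bool) → ℤ} → Extensional Φ →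
  sumCube m Φ ≡ sumCube m (λ c → Φ (updateAt c j not))
sumCube-flip (suc m) zero {Φ} Φ-ext = trans (ℤP.+-comm (sumCube m (Φ ∘ (true ∷ᶠ_))) _)
  (cong₂ _+_ (sumCube-cong m λ c → Φ-ext {false ∷ᶠ c} λ { zero → refl ; (suc _) → refl })
             (sumCube-cong m λ c → Φ-ext {true ∷ᶠ c} λ { zero → refl ; (suc _) → refl }))
sumCube-flip (suc m) (suc j) {Φ} Φ-ext = cong₂ _+_ (flip-tail true) (flip-tail false)
  where
  flip-tail : ∀ b → sumCube m (Φ ∘ (b ∷ᶠ_)) ≡ sumCube m (λ c → Φ (updateAt (b ∷ᶠ c) (suc j) not))
  flip-tail b = trans (sumCube-flip m j (λ c≗c′ → Φ-ext λ { zero → refl ; (suc t) → c≗c′ t }))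
    (sumCube-cong m λ c → Φ-ext {b ∷ᶠ updateAt c j not} λ { zero → refl ; (suc _) → refl })

negPow-suc : ∀ n → negPow (suc n) ≡ - negPow n
negPow-suc zero          = refl
negPow-suc (suc zero)    = refl
negPow-suc (suc (suc n)) = negPow-suc n

negPow-+ : ∀ a b → negPow (a ℕ.+ b) ≡ negPow a * negPow b
negPow-+ zero    b = sym (*-identityˡ _)
negPow-+ (suc a) b = begin
  negPow (suc (a ℕ.+ b))   ≡⟨ negPow-suc (a ℕ.+ b) ⟩
  - negPow (a ℕ.+ b)       ≡⟨ cong -_ (negPow-+ a b) ⟩
  - (negPow a * negPow b)  ≡⟨ ℤP.neg-distribˡ-* (negPow a) _ ⟩
  - negPow a * negPow b    ≡⟨ cong (_* negPow b) (negPow-suc a) ⟨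
  negPow (suc a) * negPow b ∎
  where open ≡-Reasoning

negPow-square : ∀ n → negPow n * negPow n ≡ 1ℤ
negPow-square zero          = refl
negPow-square (suc zero)    = refl
negPow-square (suc (suc n)) = negPow-square n

choiceSign : ∀ {m} → (Fin m → Bool) → ℤ
choiceSign c = ∏ (λ j → if c j then 1ℤ else -1ℤ)

choiceSign-cong : ∀ {m} → Extensional (choiceSign {m})
choiceSign-cong c≗c′ = Product.sum-cong-≗ (cong (λ b → if b then 1ℤ else -1ℤ) ∘ c≗c′)

choiceSign-flip : ∀ {m} (j : Fin m) c → choiceSign (updateAt c j not) ≡ - choiceSign c
choiceSign-flip zero    c with c zero
... | true  = trans (-1*i≡-i _) (cong -_ (sym (*-identityˡ _)))
... | false = trans (*-identityˡ _) (sym (trans (cong -_ (-1*i≡-i _)) (ℤP.neg-involutive _)))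
choiceSign-flip (suc j) c =
  trans (cong (sign₀ *_) (choiceSign-flip j (tail c))) (sym (ℤP.neg-distribʳ-* sign₀ _))
  where sign₀ = if c zero then 1ℤ else -1ℤ

record Linear {A : Set} (L : (A → ℤ) → ℤ) : Set where
  field
    cong-≗ : ∀ {f g} → f ≗ g → L f ≡ L g
    +-hom  : ∀ f g → L (λ a → f a + g a) ≡ L f + L g
    *-hom  : ∀ x f → L (λ a → x * f a) ≡ x * L f

  0-hom : L (λ _ → 0ℤ) ≡ 0ℤ
  0-hom = trans (*-hom 0ℤ (λ _ → 0ℤ)) (*-zeroˡ (L (λ _ → 0ℤ)))

  neg-hom : ∀ f → L (λ a → - f a) ≡ - L f
  neg-hom f = trans (cong-≗ (sym ∘ -1*i≡-i ∘ f)) (trans (*-hom -1ℤ f) (-1*i≡-i _))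

  sub-hom : ∀ f g → L (λ a → f a - g a) ≡ L f - L g
  sub-hom f g = trans (+-hom f (λ a → - g a)) (cong (L f +_) (neg-hom g))

  sum-hom : ∀ {n} (F : Fin n → A → ℤ) → L (λ a → sum (λ i → F i a)) ≡ sum (λ i → L (F i))
  sum-hom {zero}  F = 0-hom
  sum-hom {suc n} F = trans (+-hom (F zero) (λ a → sum (λ i → F (suc i) a)))
                            (cong (L (F zero) +_) (sum-hom (F ∘ suc)))

sum-linear : ∀ {n} → Linear (sum {n})
sum-linear = record
  { cong-≗ = sum-cong-≗
  ; +-hom  = ∑-distrib-+
  ; *-hom  = λ x f → sym (*-distribˡ-sum x f)
  }

sumCube-linear : ∀ m → Linear (sumCube m)
sumCube-linear m = record
  { cong-≗ = sumCube-cong m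
  ; +-hom  = +-hom m
  ; *-hom  = λ x f → sym (*-distribˡ-sumCube m x f)
  }
  where
  +-hom : ∀ m (f g : (Fin m → Bool) → ℤ) → sumCube m (λ c → f c + g c) ≡ sumCube m f + sumCube m g
  +-hom zero    f g = refl
  +-hom (suc m) f g = trans (cong₂ _+_ (+-hom m (f ∘ (true ∷ᶠ_)) (g ∘ (true ∷ᶠ_)))
                                       (+-hom m (f ∘ (false ∷ᶠ_)) (g ∘ (false ∷ᶠ_))))
    (+-interchange (sumCube m (f ∘ (true ∷ᶠ_))) (sumCube m (g ∘ (true ∷ᶠ_)))
                   (sumCube m (f ∘ (false ∷ᶠ_))) (sumCube m (g ∘ (false ∷ᶠ_))))

-- Indefinite sums

indefSum : (ℤ → ℤ) → ℤ → ℤ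
indefSum φ (ℤ.+ zero)      = 0ℤ
indefSum φ (ℤ.+ suc n)     = indefSum φ (ℤ.+ n) + φ (ℤ.+ n)
indefSum φ -[1+ zero ]     = - φ -[1+ zero ]
indefSum φ -[1+ suc n ]    = indefSum φ -[1+ n ] - φ -[1+ suc n ]

indefSum-suc : ∀ φ t → indefSum φ (1ℤ + t) ≡ indefSum φ t + φ t
indefSum-suc φ (ℤ.+ n)       = refl
indefSum-suc φ -[1+ zero ]   = sym (ℤP.+-inverseˡ (φ -[1+ zero ]))
indefSum-suc φ -[1+ suc n ]  = simplify (indefSum φ -[1+ n ]) (φ -[1+ suc n ])
  where
  simplify : ∀ a b → a ≡ a - b + b
  simplify = solve-∀

1+-invariant⇒constant : ∀ {D : ℤ → ℤ} → (∀ t → D (1ℤ + t) ≡ D t) → ∀ t → D t ≡ D 0ℤ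
1+-invariant⇒constant step (ℤ.+ zero)     = refl
1+-invariant⇒constant step (ℤ.+ suc n)    = trans (step (ℤ.+ n)) (1+-invariant⇒constant step (ℤ.+ n))
1+-invariant⇒constant step -[1+ zero ]    = sym (step -[1+ zero ])
1+-invariant⇒constant step -[1+ suc n ]   = trans (sym (step -[1+ suc n ])) (1+-invariant⇒constant step -[1+ n ])

indefSum-unique : ∀ {φ} (F : ℤ → ℤ) → F 0ℤ ≡ 0ℤ → (∀ t → F (1ℤ + t) ≡ F t + φ t) →
  ∀ t → F t ≡ indefSum φ t
indefSum-unique {φ} F F0 F-suc t =
  ℤP.i-j≡0⇒i≡j (F t) (indefSum φ t) (trans (1+-invariant⇒constant step t) (cong (_- 0ℤ) F0))
  where
  cancel : ∀ a b x → a + x - (b + x) ≡ a - b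
  cancel = solve-∀
  step : ∀ t → F (1ℤ + t) - indefSum φ (1ℤ + t) ≡ F t - indefSum φ t
  step t = trans (cong₂ _-_ (F-suc t) (indefSum-suc φ t)) (cancel (F t) (indefSum φ t) (φ t))

indefSum-linear : ∀ t → Linear (λ φ → indefSum φ t)
indefSum-linear t = record
  { cong-≗ = λ {φ} {ψ} φ≗ψ → sym (indefSum-unique {φ} (indefSum ψ) refl
                               (λ t → trans (indefSum-suc ψ t) (cong (indefSum ψ t +_) (sym (φ≗ψ t)))) t)
  ; +-hom  = λ φ ψ → sym (indefSum-unique {λ x → φ x + ψ x} (λ t → indefSum φ t + indefSum ψ t) refl
                               (λ t → trans (cong₂ _+_ (indefSum-suc φ t) (indefSum-suc ψ t))
                                            (+-interchange (indefSum φ t) (φ t) (indefSum ψ t) (ψ t))) t)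
  ; *-hom  = λ x φ → sym (indefSum-unique {λ y → x * φ y} (λ t → x * indefSum φ t) (*-zeroʳ x)
                               (λ t → trans (cong (x *_) (indefSum-suc φ t)) (ℤP.*-distribˡ-+ x _ _)) t)
  }

indefSum-comm : ∀ {A : Set} {L : (A → ℤ) → ℤ} → Linear L → ∀ (F : ℤ → A → ℤ) t →
  L (λ a → indefSum (λ x → F x a) t) ≡ indefSum (λ x → L (F x)) t
indefSum-comm {L = L} lin F = indefSum-unique {λ x → L (F x)} (λ t → L (λ a → indefSum (λ x → F x a) t))
  (Linear.0-hom lin)
  (λ t → trans (Linear.cong-≗ lin (λ a → indefSum-suc (λ x → F x a) t))
               (Linear.+-hom lin (λ a → indefSum (λ x → F x a) t) (F t)))

indefSum-shift : ∀ φ c t → indefSum (λ x → φ (x + c)) t ≡ indefSum φ (t + c) - indefSum φ c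
indefSum-shift φ c t = sym (indefSum-unique {λ x → φ (x + c)} (λ t → indefSum φ (t + c) - indefSum φ c)
  (trans (cong (λ u → indefSum φ u - indefSum φ c) (+-identityˡ c)) (ℤP.+-inverseʳ (indefSum φ c)))
  step t)
  where
  reassoc : ∀ t c → 1ℤ + t + c ≡ 1ℤ + (t + c)
  reassoc = solve-∀
  regroup : ∀ p x q → p + x - q ≡ p - q + x
  regroup = solve-∀
  step : ∀ t → indefSum φ (1ℤ + t + c) - indefSum φ c ≡ indefSum φ (t + c) - indefSum φ c + φ (t + c)
  step t = trans (cong (λ u → indefSum φ u - indefSum φ c) (reassoc t c))
    (trans (cong (_- indefSum φ c) (indefSum-suc φ (t + c))) (regroup (indefSum φ (t + c)) (φ (t + c)) (indefSum φ c)))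

-- Finite differences and degree

δ : (ℤ → ℤ) → ℤ → ℤ
δ φ t = φ (t + 1ℤ) - φ t

δ^ : ℕ → (ℤ → ℤ) → ℤ → ℤ
δ^ r = iter r δ

iter-suc : ∀ {A : Set} r (f : A → A) x → iter (suc r) f x ≡ iter r f (f x)
iter-suc zero    f x = refl
iter-suc (suc r) f x = cong f (iter-suc r f x)

δ^-cong : ∀ r {φ ψ} → φ ≗ ψ → δ^ r φ ≗ δ^ r ψ
δ^-cong zero    φ≗ψ t = φ≗ψ t
δ^-cong (suc r) φ≗ψ t = cong₂ _-_ (δ^-cong r φ≗ψ (t + 1ℤ)) (δ^-cong r φ≗ψ t)

δ^-comm : ∀ {A : Set} {L : (A → ℤ) → ℤ} → Linear L → ∀ r (F : A → ℤ → ℤ) t →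
  δ^ r (λ s → L (λ a → F a s)) t ≡ L (λ a → δ^ r (F a) t)
δ^-comm lin zero    F t = refl
δ^-comm lin (suc r) F t = trans (cong₂ _-_ (δ^-comm lin r F (t + 1ℤ)) (δ^-comm lin r F t))
  (sym (Linear.sub-hom lin (λ a → δ^ r (F a) (t + 1ℤ)) (λ a → δ^ r (F a) t)))

DegBelow : ℕ → (ℤ → ℤ) → Set
DegBelow d φ = ∀ t → δ^ d φ t ≡ 0ℤ

DegBelow-cong : ∀ d {φ ψ} → φ ≗ ψ → DegBelow d φ → DegBelow d ψ
DegBelow-cong d φ≗ψ φ-deg t = trans (sym (δ^-cong d φ≗ψ t)) (φ-deg t)

DegBelow-suc : ∀ d {φ} → DegBelow d φ → DegBelow (suc d) φ
DegBelow-suc d φ-deg t = cong₂ _-_ (φ-deg (t + 1ℤ)) (φ-deg t)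

DegBelow-linear : ∀ d {A : Set} {L : (A → ℤ) → ℤ} → Linear L → ∀ (F : A → ℤ → ℤ) →
  (∀ a → DegBelow d (F a)) → DegBelow d (λ s → L (λ a → F a s))
DegBelow-linear d lin F F-deg t =
  trans (δ^-comm lin d F t) (trans (Linear.cong-≗ lin (λ a → F-deg a t)) (Linear.0-hom lin))

DegBelow-const : ∀ d c → DegBelow (suc d) (λ _ → c)
DegBelow-const zero    c t = ℤP.+-inverseʳ c
DegBelow-const (suc d) c   = DegBelow-suc (suc d) (DegBelow-const d c)

DegBelow-shift : ∀ d c {φ} → DegBelow d φ → DegBelow d (λ t → φ (t + c))
DegBelow-shift d c {φ} φ-deg t = trans (shift d t) (φ-deg (t + c))
  where
  reassoc : ∀ t c → t + 1ℤ + c ≡ t + c + 1ℤ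
  reassoc = solve-∀
  shift : ∀ r t → δ^ r (λ t → φ (t + c)) t ≡ δ^ r φ (t + c)
  shift zero    t = refl
  shift (suc r) t = cong₂ _-_ (trans (shift r (t + 1ℤ)) (cong (δ^ r φ) (reassoc t c))) (shift r t)

δ^-* : ∀ r c φ t → δ^ r (λ s → c * φ s) t ≡ c * δ^ r φ t
δ^-* zero    c φ t = refl
δ^-* (suc r) c φ t = trans (cong₂ _-_ (δ^-* r c φ (t + 1ℤ)) (δ^-* r c φ t)) (factor c _ _)
  where
  factor : ∀ x p q → x * p - x * q ≡ x * (p - q)
  factor = solve-∀

DegBelow-* : ∀ d c {φ} → DegBelow d φ → DegBelow d (λ t → c * φ t)
DegBelow-* d c {φ} φ-deg t = trans (δ^-* d c φ t) (trans (cong (c *_) (φ-deg t)) (*-zeroʳ c))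

DegBelow-indefSum : ∀ d {φ} → DegBelow d φ → DegBelow (suc d) (indefSum φ)
DegBelow-indefSum d {φ} φ-deg t =
  trans (cong-app (iter-suc d δ (indefSum φ)) t) (trans (δ^-cong d δ-indefSum t) (φ-deg t))
  where
  cancel : ∀ a b → a + b - a ≡ b
  cancel = solve-∀
  δ-indefSum : δ (indefSum φ) ≗ φ
  δ-indefSum x = trans (cong (λ u → indefSum φ u - indefSum φ x) (ℤP.+-comm x 1ℤ))
    (trans (cong (_- indefSum φ x) (indefSum-suc φ x)) (cancel (indefSum φ x) (φ x)))

-- Sums over boxes

defSum : ℤ → ℤ → (ℤ → ℤ) → ℤ
defSum a b φ = indefSum φ b - indefSum φ a

defSum-linear : ∀ a b → Linear (defSum a b)
defSum-linear a b = record
  { cong-≗ = λ φ≗ψ → cong₂ _-_ (Lb.cong-≗ φ≗ψ) (La.cong-≗ φ≗ψ)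
  ; +-hom  = λ φ ψ → trans (cong₂ _-_ (Lb.+-hom φ ψ) (La.+-hom φ ψ))
                           (sub-interchange (indefSum φ b) (indefSum ψ b) (indefSum φ a) (indefSum ψ a))
  ; *-hom  = λ x φ → trans (cong₂ _-_ (Lb.*-hom x φ) (La.*-hom x φ)) (factor x (indefSum φ b) (indefSum φ a))
  }
  where
  module La = Linear (indefSum-linear a)
  module Lb = Linear (indefSum-linear b)
  sub-interchange : ∀ p q r s → p + q - (r + s) ≡ p - r + (q - s)
  sub-interchange = solve-∀
  factor : ∀ x p q → x * p - x * q ≡ x * (p - q)
  factor = solve-∀

defSum-comm : ∀ {A : Set} {L : (A → ℤ) → ℤ} → Linear L → ∀ (F : ℤ → A → ℤ) s t →
  L (λ a → defSum s t (λ x → F x a)) ≡ defSum s t (λ x → L (F x))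
defSum-comm lin F s t = trans (Linear.sub-hom lin _ _)
  (cong₂ _-_ (indefSum-comm lin F t) (indefSum-comm lin F s))

defSum-shift : ∀ φ c a b → defSum a b (λ x → φ (x + c)) ≡ defSum (a + c) (b + c) φ
defSum-shift φ c a b = trans (cong₂ _-_ (indefSum-shift φ c b) (indefSum-shift φ c a))
  (cancel (indefSum φ (b + c)) (indefSum φ (a + c)) (indefSum φ c))
  where
  cancel : ∀ p q r → p - r - (q - r) ≡ p - q
  cancel = solve-∀

orientation : ℤ → ℤ → ℤ
orientation a b = if does (a ℤ.<? b) then 1ℤ else -1ℤ

orientation-defSum : ∀ a b φ → orientation a b * defSum (a ⊓ b) (a ⊔ b) φ ≡ defSum a b φ
orientation-defSum a b φ with a ℤ.<? b
... | yes a<b = trans (*-identityˡ _)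
  (cong₂ (λ u v → defSum u v φ) (ℤP.i≤j⇒i⊓j≡i (ℤP.<⇒≤ a<b)) (ℤP.i≤j⇒i⊔j≡j (ℤP.<⇒≤ a<b)))
... | no a≮b = trans
  (cong (-1ℤ *_) (cong₂ (λ u v → defSum u v φ) (ℤP.i≥j⇒i⊓j≡j (ℤP.≮⇒≥ a≮b))
                                                (ℤP.i≥j⇒i⊔j≡i (ℤP.≮⇒≥ a≮b))))
  (reverse (indefSum φ a) (indefSum φ b))
  where
  reverse : ∀ p q → -1ℤ * (p - q) ≡ q - p
  reverse = solve-∀

boxSum : ∀ m → (Fin m → ℤ) → (Fin m → ℤ) → ((Fin m → ℤ) → ℤ) → ℤ
boxSum zero    a b g = g (λ ())
boxSum (suc m) a b g = defSum (a zero) (b zero) (λ x → boxSum m (tail a) (tail b) (g ∘ (x ∷ᶠ_)))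

boxSum-linear : ∀ m a b → Linear (boxSum m a b)
boxSum-linear zero    a b = record { cong-≗ = λ g≗h → g≗h _ ; +-hom = λ _ _ → refl ; *-hom = λ _ _ → refl }
boxSum-linear (suc m) a b = record
  { cong-≗ = λ g≗h → D.cong-≗ (λ x → B.cong-≗ (g≗h ∘ (x ∷ᶠ_)))
  ; +-hom  = λ g h → trans (D.cong-≗ (λ x → B.+-hom (g ∘ (x ∷ᶠ_)) (h ∘ (x ∷ᶠ_)))) (D.+-hom _ _)
  ; *-hom  = λ c g → trans (D.cong-≗ (λ x → B.*-hom c (g ∘ (x ∷ᶠ_)))) (D.*-hom c _)
  }
  where
  module D = Linear (defSum-linear (a zero) (b zero))
  module B = Linear (boxSum-linear m (tail a) (tail b))

boxSum-cong : ∀ m {a a′ b b′} → a ≗ a′ → b ≗ b′ → ∀ g → boxSum m a b g ≡ boxSum m a′ b′ g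
boxSum-cong zero    a≗a′ b≗b′ g = refl
boxSum-cong (suc m) {a} {a′} {b} {b′} a≗a′ b≗b′ g = trans
  (cong₂ (λ u v → defSum u v _) (a≗a′ zero) (b≗b′ zero))
  (Linear.cong-≗ (defSum-linear (a′ zero) (b′ zero))
    (λ x → boxSum-cong m (a≗a′ ∘ suc) (b≗b′ ∘ suc) (g ∘ (x ∷ᶠ_))))

zeros : ∀ {m} → Fin m → ℤ
zeros _ = 0ℤ

choose : ∀ {m} → (Fin m → Bool) → (Fin m → ℤ) → (Fin m → ℤ) → Fin m → ℤ
choose c a b j = if c j then b j else a j

boxSum-inclusion-exclusion : ∀ m a b g →
  boxSum m a b g ≡ sumCube m (λ c → choiceSign c * boxSum m zeros (choose c a b) g)
boxSum-inclusion-exclusion zero    a b g = sym (*-identityˡ _)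
boxSum-inclusion-exclusion (suc m) a b g = begin
  indefSum Φ (b zero) - indefSum Φ (a zero)
    ≡⟨ cong₂ _-_ (indefSum-Φ (b zero)) (indefSum-Φ (a zero)) ⟩
  sumCube m (λ c → choiceSign c * I c (b zero)) - sumCube m (λ c → choiceSign c * I c (a zero))
    ≡⟨ cong₂ _+_ (sumCube-cong m (λ c → upper (choiceSign c) (I c (b zero))))
                 (trans (sym (Cube.neg-hom _)) (sumCube-cong m (λ c → lower (choiceSign c) (I c (a zero))))) ⟩
  sumCube m (λ c → 1ℤ * choiceSign c * (I c (b zero) - 0ℤ))
    + sumCube m (λ c → -1ℤ * choiceSign c * (I c (a zero) - 0ℤ)) ∎
  where
  open ≡-Reasoning
  module Cube = Linear (sumCube-linear m)
  Φ : ℤ → ℤ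
  Φ x = boxSum m (tail a) (tail b) (g ∘ (x ∷ᶠ_))
  Ψ : (Fin m → Bool) → ℤ → ℤ
  Ψ c x = boxSum m zeros (choose c (tail a) (tail b)) (g ∘ (x ∷ᶠ_))
  I : (Fin m → Bool) → ℤ → ℤ
  I c = indefSum (Ψ c)
  indefSum-Φ : ∀ t → indefSum Φ t ≡ sumCube m (λ c → choiceSign c * I c t)
  indefSum-Φ t = begin
    indefSum Φ t
      ≡⟨ Linear.cong-≗ (indefSum-linear t) (λ x → boxSum-inclusion-exclusion m _ _ (g ∘ (x ∷ᶠ_))) ⟩
    indefSum (λ x → sumCube m (λ c → choiceSign c * Ψ c x)) t
      ≡⟨ indefSum-comm (sumCube-linear m) (λ x c → choiceSign c * Ψ c x) t ⟨
    sumCube m (λ c → indefSum (λ x → choiceSign c * Ψ c x) t)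
      ≡⟨ sumCube-cong m (λ c → Linear.*-hom (indefSum-linear t) (choiceSign c) (Ψ c)) ⟩
    sumCube m (λ c → choiceSign c * I c t) ∎
  upper : ∀ s p → s * p ≡ 1ℤ * s * (p - 0ℤ)
  upper = solve-∀
  lower : ∀ s p → - (s * p) ≡ -1ℤ * s * (p - 0ℤ)
  lower = solve-∀

DegBelowEach : ∀ {m} → ℕ → ((Fin m → ℤ) → ℤ) → Set
DegBelowEach d F = ∀ i z → DegBelow d (λ t → F (z [ i ]≔ t))

boxSum-DegBelowEach : ∀ m d {g} → Extensional g → DegBelowEach d g →
  DegBelowEach (suc d) (λ z → boxSum m zeros z g)
boxSum-DegBelowEach (suc m) d {g} g-ext g-deg zero z =
  DegBelow-cong (suc d) (λ t → sym (+-identityʳ _)) (DegBelow-indefSum d Φ-deg)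
  where
  Φ-deg : DegBelow d (λ x → boxSum m zeros (tail z) (g ∘ (x ∷ᶠ_)))
  Φ-deg = DegBelow-linear d (boxSum-linear m zeros (tail z)) (λ r x → g (x ∷ᶠ r))
    (λ r → DegBelow-cong d (λ x → g-ext {(0ℤ ∷ᶠ r) [ zero ]≔ x} λ { zero → refl ; (suc _) → refl })
                         (g-deg zero (0ℤ ∷ᶠ r)))
boxSum-DegBelowEach (suc m) d {g} g-ext g-deg (suc i) z =
  DegBelow-linear (suc d) (defSum-linear 0ℤ (z zero))
    (λ x t → boxSum m zeros (tail z [ i ]≔ t) (g ∘ (x ∷ᶠ_)))
    (λ x → boxSum-DegBelowEach m d (g-ext ∘ ∷-cong x)
             (λ i′ w → DegBelow-cong d
                         (λ t → g-ext {(x ∷ᶠ w) [ suc i′ ]≔ t} λ { zero → refl ; (suc _) → refl })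
                         (g-deg (suc i′) (x ∷ᶠ w)))
             i (tail z))

-- Alternating functions

Alternating : ∀ {A : Set} {m} → ((Fin (suc m) → A) → ℤ) → Set
Alternating F = ∀ k v → F (v ∘ swap k) ≡ - F v

x≡-x⇒x≡0 : ∀ {x} → x ≡ - x → x ≡ 0ℤ
x≡-x⇒x≡0 {ℤ.+ zero}   _  = refl
x≡-x⇒x≡0 {ℤ.+ suc n}  ()
x≡-x⇒x≡0 { -[1+ n ] } ()

swap-fixes : ∀ {A : Set} {m} (k : Fin m) (v : Fin (suc m) → A) →
  v (inject₁ k) ≡ v (suc k) → v ∘ swap k ≗ v
swap-fixes k v v≡ t with t FinP.≟ inject₁ k | t FinP.≟ suc k
... | yes refl | _        = trans (cong v (swap-inject₁ k)) (sym v≡)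
... | no _     | yes refl = trans (cong v (swap-suc k)) v≡
... | no t≢k   | no t≢k′  = cong v (swap-other k t t≢k t≢k′)

Alternating-vanishes : ∀ {A : Set} {m} {F : (Fin (suc m) → A) → ℤ} → Extensional F → Alternating F →
  ∀ k v → v (inject₁ k) ≡ v (suc k) → F v ≡ 0ℤ
Alternating-vanishes F-ext F-alt k v v≡ = x≡-x⇒x≡0 (trans (sym (F-ext (swap-fixes k v v≡))) (F-alt k v))

boxSum-alternating : ∀ m {g} → Extensional g → Alternating g →
  Alternating (λ z → boxSum (suc m) zeros z g)
boxSum-alternating (suc m) {g} g-ext g-alt zero z = begin
  defSum 0ℤ (z (suc zero)) (λ x → defSum 0ℤ (z zero) (B x))
    ≡⟨ defSum-comm (defSum-linear 0ℤ (z zero)) (λ x x′ → B x x′) 0ℤ (z (suc zero)) ⟨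
  defSum 0ℤ (z zero) (λ x′ → defSum 0ℤ (z (suc zero)) (λ x → B x x′))
    ≡⟨ Outer.cong-≗ (λ x′ → Inner.cong-≗ (λ x → B-swap x x′)) ⟩
  defSum 0ℤ (z zero) (λ x′ → defSum 0ℤ (z (suc zero)) (λ x → - B x′ x))
    ≡⟨ Outer.cong-≗ (λ x′ → Inner.neg-hom (B x′)) ⟩
  defSum 0ℤ (z zero) (λ x′ → - defSum 0ℤ (z (suc zero)) (B x′))
    ≡⟨ Outer.neg-hom _ ⟩
  - defSum 0ℤ (z zero) (λ x′ → defSum 0ℤ (z (suc zero)) (B x′)) ∎
  where
  open ≡-Reasoning
  module Outer = Linear (defSum-linear 0ℤ (z zero))
  module Inner = Linear (defSum-linear 0ℤ (z (suc zero)))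
  B : ℤ → ℤ → ℤ
  B x x′ = boxSum m zeros (tail (tail z)) (λ r → g (x ∷ᶠ (x′ ∷ᶠ r)))
  B-swap : ∀ x x′ → B x x′ ≡ - B x′ x
  B-swap x x′ = trans
    (Linear.cong-≗ (boxSum-linear m zeros (tail (tail z)))
      (λ r → trans (g-ext λ { zero → refl ; (suc zero) → refl ; (suc (suc _)) → refl })
                   (g-alt zero (x′ ∷ᶠ (x ∷ᶠ r)))))
    (Linear.neg-hom (boxSum-linear m zeros (tail (tail z))) _)
boxSum-alternating (suc m) {g} g-ext g-alt (suc k) z = trans
  (D.cong-≗ (λ x → boxSum-alternating m (g-ext ∘ ∷-cong x)
                     (λ k′ v → trans (g-ext λ { zero → refl ; (suc _) → refl }) (g-alt (suc k′) (x ∷ᶠ v)))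
                     k (tail z)))
  (D.neg-hom _)
  where
  module D = Linear (defSum-linear 0ℤ (z zero))

sg : ℕ → ℕ → ℤ
sg zero    zero    = 0ℤ
sg zero    (suc y) = -1ℤ
sg (suc x) zero    = 1ℤ
sg (suc x) (suc y) = sg x y

sg-antisym : ∀ x y → sg x y ≡ - sg y x
sg-antisym zero    zero    = refl
sg-antisym zero    (suc y) = refl
sg-antisym (suc x) zero    = refl
sg-antisym (suc x) (suc y) = sg-antisym x y

sg-refl : ∀ x → sg x x ≡ 0ℤ
sg-refl zero    = refl
sg-refl (suc x) = sg-refl x

sg-> : ∀ {x y} → y ℕ.< x → sg x y ≡ 1ℤ
sg-> {suc x} {zero}  _         = refl
sg-> {suc x} {suc y} (s≤s y<x) = sg-> y<x

-- the sign of the permutation sorting v, or 0 if v repeats a value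
seqSign : ∀ {m} → (Fin m → ℕ) → ℤ
seqSign {zero}  v = 1ℤ
seqSign {suc m} v = ∏ (λ b → sg (v (suc b)) (v zero)) * seqSign (tail v)

seqSign-cong : ∀ {m} → Extensional (seqSign {m})
seqSign-cong {zero}  v≗w = refl
seqSign-cong {suc m} v≗w =
  cong₂ _*_ (Product.sum-cong-≗ (λ b → cong₂ sg (v≗w (suc b)) (v≗w zero))) (seqSign-cong (v≗w ∘ suc))

seqSign-alternating : ∀ {m} → Alternating (seqSign {suc m})
seqSign-alternating {suc m} zero v = begin
  (sg (v zero) (v (suc zero)) * A) * (B * C)
    ≡⟨ cong (λ s → (s * A) * (B * C)) (sg-antisym (v zero) (v (suc zero))) ⟩
  (- sg (v (suc zero)) (v zero) * A) * (B * C)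
    ≡⟨ rearrange (sg (v (suc zero)) (v zero)) A B C ⟩
  - ((sg (v (suc zero)) (v zero) * B) * (A * C)) ∎
  where
  open ≡-Reasoning
  A = ∏ (λ b → sg (v (suc (suc b))) (v (suc zero)))
  B = ∏ (λ b → sg (v (suc (suc b))) (v zero))
  C = seqSign (tail (tail v))
  rearrange : ∀ s a b c → (- s * a) * (b * c) ≡ - ((s * b) * (a * c))
  rearrange = solve-∀
seqSign-alternating {suc m} (suc k) v = trans
  (cong₂ _*_ (sym (Product.sum-permute (λ b → sg (v (suc b)) (v zero)) (swapPermutation k)))
             (seqSign-alternating k (tail v)))
  (sym (ℤP.neg-distribʳ-* (∏ (λ b → sg (v (suc b)) (v zero))) (seqSign (tail v))))

seqSign-∷-repeat : ∀ {m} x (v : Fin m → ℕ) j → v j ≡ x → seqSign (x ∷ᶠ v) ≡ 0ℤ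
seqSign-∷-repeat x v j v≡x =
  trans (cong (_* seqSign v) (∏-zero _ j (trans (cong (λ u → sg u x) v≡x) (sg-refl x)))) (*-zeroˡ (seqSign v))

seqSign-increasing : ∀ {m} (v : Fin m → ℕ) → (∀ a b → toℕ a ℕ.< toℕ b → v a ℕ.< v b) →
  seqSign v ≡ 1ℤ
seqSign-increasing {zero}  v v-inc = refl
seqSign-increasing {suc m} v v-inc = cong₂ _*_
  (∏-one _ (λ b → sg-> (v-inc zero (suc b) (s≤s z≤n))))
  (seqSign-increasing (tail v) (λ a b a<b → v-inc (suc a) (suc b) (s≤s a<b)))

seqSign-∷-replace : ∀ {m} (v : Fin m → ℕ) j p → seqSign (v j ∷ᶠ (v [ j ]≔ p)) ≡ - seqSign (p ∷ᶠ v)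
seqSign-∷-replace v zero    p = trans
  (seqSign-cong {u = v zero ∷ᶠ (v [ zero ]≔ p)} {v = (p ∷ᶠ v) ∘ swap zero}
    λ { zero → refl ; (suc zero) → refl ; (suc (suc _)) → refl })
  (seqSign-alternating zero (p ∷ᶠ v))
seqSign-∷-replace v (suc j) p = begin
  (sg h q * Xq′) * (Yh′ * S′)
    ≡⟨ cong (λ s → (s * Xq′) * (Yh′ * S′)) (sg-antisym h q) ⟩
  (- sg q h * Xq′) * (Yh′ * S′)
    ≡⟨ regroup (sg q h) Xq′ Yh′ S′ ⟩
  - ((Yh′ * sg q h) * (Xq′ * S′))
    ≡⟨ cong₂ (λ a b → - (a * b)) update (seqSign-∷-replace u j p) ⟩
  - ((Yh * sg p h) * - (Xp * S))
    ≡⟨ cong (λ s → - ((Yh * s) * - (Xp * S))) (sg-antisym p h) ⟩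
  - ((Yh * - sg h p) * - (Xp * S))
    ≡⟨ regroup′ (sg h p) Xp Yh S ⟩
  - ((sg h p * Xp) * (Yh * S)) ∎
  where
  open ≡-Reasoning
  h = v zero
  u = tail v
  q = u j
  u′ = u [ j ]≔ p
  Xq′ = ∏ (λ b → sg (u′ b) q)
  Yh′ = ∏ (λ b → sg (u′ b) h)
  S′  = seqSign u′
  Xp  = ∏ (λ b → sg (u b) p)
  Yh  = ∏ (λ b → sg (u b) h)
  S   = seqSign u
  update : Yh′ * sg q h ≡ Yh * sg p h
  update = trans (cong (_* sg q h) (Product.sum-cong-≗ (map-updateAt-local {f = λ x → sg x h} u j refl)))
                 (∏-update (λ b → sg (u b) h) j (sg p h))
  regroup : ∀ a x y s → (- a * x) * (y * s) ≡ - ((y * a) * (x * s))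
  regroup = solve-∀
  regroup′ : ∀ b x y s → - ((y * - b) * - (x * s)) ≡ - ((b * x) * (y * s))
  regroup′ = solve-∀

below : ∀ {N} → Fin N → Fin N → ℕ
below x y = if does (toℕ x ℕ.<? toℕ y) then 1 else 0

inversions : ∀ {N n} → (Fin n → Fin N) → ℕ
inversions {n = zero}  v = 0
inversions {n = suc n} v = Sumℕ.sum (λ b → below (v (suc b)) (v zero)) ℕ.+ inversions (tail v)

inversions-swap : ∀ {N n} (k : Fin n) (v : Fin (suc n) → Fin N) →
  toℕ (v (suc k)) ℕ.< toℕ (v (inject₁ k)) → suc (inversions (v ∘ swap k)) ≡ inversions v
inversions-swap zero v descent
  rewrite dec-true  (toℕ (v (suc zero)) ℕ.<? toℕ (v zero)) descent
        | dec-false (toℕ (v zero) ℕ.<? toℕ (v (suc zero))) (ℕP.<⇒≯ descent) =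
  cong suc (ℕ-+-left-comm (Sumℕ.sum (λ b → below (v (suc (suc b))) (v (suc zero))))
                         (Sumℕ.sum (λ b → below (v (suc (suc b))) (v zero)))
                         (inversions (tail (tail v))))
inversions-swap (suc k) v descent = trans (sym (ℕP.+-suc _ _))
  (cong₂ ℕ._+_ (sym (Sumℕ.sum-permute (λ b → below (v (suc b)) (v zero)) (swapPermutation k)))
               (inversions-swap k (tail v) descent))

Sorted : ∀ {N n} → (Fin (suc n) → Fin N) → Set
Sorted {n = n} w = ∀ (k : Fin n) → toℕ (w (inject₁ k)) ℕ.≤ toℕ (w (suc k))

module _ {N m} {F G : (Fin (suc m) → Fin N) → ℤ} (F-alt : Alternating F) (G-alt : Alternating G)
         (F≡G-sorted : ∀ w → Sorted w → F w ≡ G w) where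

  private
    agree-within : ∀ bound w → inversions w ℕ.< bound → F w ≡ G w
    agree-within (suc bound) w w<bound with any? (λ k → toℕ (w (suc k)) ℕ.<? toℕ (w (inject₁ k)))
    ... | yes (k , descent) = ℤP.neg-injective (begin
      - F w             ≡⟨ F-alt k w ⟨
      F (w ∘ swap k)    ≡⟨ agree-within bound (w ∘ swap k) fewer ⟩
      G (w ∘ swap k)    ≡⟨ G-alt k w ⟩
      - G w             ∎)
      where
      open ≡-Reasoning
      fewer : inversions (w ∘ swap k) ℕ.< bound
      fewer = ℕP.≤-pred (subst (λ i → suc i ℕ.≤ suc bound) (sym (inversions-swap k w descent)) w<bound)
    ... | no no-descent = F≡G-sorted w (λ k → ℕP.≮⇒≥ (λ descent → no-descent (k , descent)))

  Alternating-sorted-unique : ∀ w → F w ≡ G w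
  Alternating-sorted-unique w = agree-within (suc (inversions w)) w ℕP.≤-refl

StrictlySorted : ∀ {N n} → (Fin (suc n) → Fin N) → Set
StrictlySorted {n = n} w = ∀ (k : Fin n) → toℕ (w (inject₁ k)) ℕ.< toℕ (w (suc k))

strictlySorted⇒punchIn : ∀ {m} (w : Fin (suc m) → Fin (suc (suc m))) → StrictlySorted w →
  ∃ λ r → w ≗ punchIn r
strictlySorted⇒punchIn {zero} w _ with w zero in w₀
... | zero     = suc zero , λ { zero → w₀ }
... | suc zero = zero     , λ { zero → w₀ }
strictlySorted⇒punchIn {suc m} w w-sorted = extend (w zero) refl (strictlySorted⇒punchIn w′ w′-sorted)
  where
  w≢0 : ∀ t → zero ≢ w (suc t)
  w≢0 t w≡0 = ℕP.n≮0 (subst (λ x → toℕ (w (inject₁ t)) ℕ.< toℕ x) (sym w≡0) (w-sorted t))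
  w′ : Fin (suc m) → Fin (suc (suc m))
  w′ t = punchOut (w≢0 t)
  w′-sorted : StrictlySorted w′
  w′-sorted k = ℕP.≤-pred (subst₂ (λ a b → toℕ a ℕ.< toℕ b)
    (sym (punchIn-punchOut (w≢0 (inject₁ k)))) (sym (punchIn-punchOut (w≢0 (suc k)))) (w-sorted (suc k)))
  tail≗ : ∀ {r′} → w′ ≗ punchIn r′ → ∀ t → w (suc t) ≡ suc (punchIn r′ t)
  tail≗ w′≗ t = trans (sym (punchIn-punchOut (w≢0 t))) (cong suc (w′≗ t))
  head< : ∀ {x r′} → w zero ≡ suc x → w′ ≗ punchIn r′ → toℕ x ℕ.< toℕ (punchIn r′ zero)
  head< w₀ w′≗ = ℕP.≤-pred (subst₂ (λ a b → toℕ a ℕ.< toℕ b) w₀ (tail≗ w′≗ zero) (w-sorted zero))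
  extend : ∀ x → w zero ≡ x → (∃ λ r′ → w′ ≗ punchIn r′) → ∃ λ r → w ≗ punchIn r
  extend zero    w₀ (r′     , w′≗) = suc r′ , λ { zero → w₀ ; (suc t) → tail≗ {r′} w′≗ t }
  extend (suc x) w₀ (zero   , w′≗) =
    zero , λ { zero → trans w₀ (cong suc x≡0) ; (suc t) → tail≗ {zero} w′≗ t }
    where
    x≡0 : x ≡ zero
    x≡0 = toℕ-injective (ℕP.n<1⇒n≡0 (head< {r′ = zero} w₀ w′≗))
  extend (suc x) w₀ (suc r″ , w′≗) = ⊥-elim (ℕP.n≮0 (head< {r′ = suc r″} w₀ w′≗))

punchIn-strictlyIncreasing : ∀ {n} (r : Fin (suc n)) a b →
  toℕ a ℕ.< toℕ b → toℕ (punchIn r a) ℕ.< toℕ (punchIn r b)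
punchIn-strictlyIncreasing r a b a<b = ℕP.≤∧≢⇒< (punchIn-mono-≤ r a b (ℕP.<⇒≤ a<b))
  (λ eq → ℕP.<⇒≢ a<b (cong toℕ (punchIn-injective r a b (toℕ-injective eq))))

∏-sg-punchIn : ∀ {n} (r : Fin (suc n)) → ∏ (λ b → sg (toℕ (punchIn r b)) (toℕ r)) ≡ negPow (toℕ r)
∏-sg-punchIn {zero}  zero    = refl
∏-sg-punchIn {suc n} zero    = ∏-one {suc n} (λ b → sg (suc (toℕ b)) 0) (λ _ → refl)
∏-sg-punchIn {suc n} (suc r) =
  trans (cong (-1ℤ *_) (∏-sg-punchIn r)) (trans (-1*i≡-i _) (sym (negPow-suc (toℕ r))))

seqSign-∷-punchIn : ∀ {n} (r : Fin (suc n)) → seqSign (toℕ r ∷ᶠ (toℕ ∘ punchIn r)) ≡ negPow (toℕ r)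
seqSign-∷-punchIn r = trans
  (cong₂ _*_ (∏-sg-punchIn r) (seqSign-increasing (toℕ ∘ punchIn r) (punchIn-strictlyIncreasing r)))
  (*-identityʳ _)

-- the analogue of the Laplace expansion of a determinant along its first row
module Expansion {m} {H : (Fin (suc m) → ℤ) → ℤ} (H-ext : Extensional H) (H-alt : Alternating H)
                 (y : Fin (suc (suc m)) → ℤ) where

  term : (Fin (suc m) → Fin (suc (suc m))) → Fin (suc (suc m)) → ℤ
  term w r = negPow (toℕ r) * seqSign (toℕ r ∷ᶠ (toℕ ∘ w)) * H (y ∘ punchIn r)

  private
    term-zero : ∀ {w r} → seqSign (toℕ r ∷ᶠ (toℕ ∘ w)) ≡ 0ℤ → term w r ≡ 0ℤ
    term-zero {w} {r} s≡0 = trans (cong (λ s → negPow (toℕ r) * s * H (y ∘ punchIn r)) s≡0)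
      (trans (cong (_* H (y ∘ punchIn r)) (*-zeroʳ (negPow (toℕ r)))) (*-zeroˡ (H (y ∘ punchIn r))))

    expansion-alternating : Alternating (λ w → sum (term w))
    expansion-alternating k w = trans (sum-cong-≗ term-swap) (Linear.neg-hom sum-linear (term w))
      where
      negate : ∀ a s h → a * - s * h ≡ - (a * s * h)
      negate = solve-∀
      term-swap : ∀ r → term (w ∘ swap k) r ≡ - term w r
      term-swap r = trans
        (cong (λ s → negPow (toℕ r) * s * H (y ∘ punchIn r))
          (trans (seqSign-cong {u = toℕ r ∷ᶠ (toℕ ∘ w ∘ swap k)} {v = (toℕ r ∷ᶠ (toℕ ∘ w)) ∘ swap (suc k)}
                               (λ { zero → refl ; (suc _) → refl }))
                 (seqSign-alternating (suc k) (toℕ r ∷ᶠ (toℕ ∘ w)))))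
        (negate (negPow (toℕ r)) (seqSign (toℕ r ∷ᶠ (toℕ ∘ w))) (H (y ∘ punchIn r)))

    expansion-sorted : ∀ w → Sorted w → H (y ∘ w) ≡ sum (term w)
    expansion-sorted w w-sorted with any? (λ k → toℕ (w (inject₁ k)) ℕ.≟ toℕ (w (suc k)))
    ... | yes (k , repeat) = trans
      (Alternating-vanishes H-ext H-alt k (y ∘ w) (cong y (toℕ-injective repeat)))
      (sym (sum-zero _ λ r → term-zero {w} {r}
        (Alternating-vanishes seqSign-cong seqSign-alternating (suc k) (toℕ r ∷ᶠ (toℕ ∘ w)) repeat)))
    ... | no no-repeat = trans (H-ext (cong y ∘ w≗)) (sym (trans (sum-single (term w) r₀ off-r₀) on-r₀))
      where
      w-strict : StrictlySorted w
      w-strict k = ℕP.≤∧≢⇒< (w-sorted k) (λ eq → no-repeat (k , eq))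
      r₀ = proj₁ (strictlySorted⇒punchIn w w-strict)
      w≗ = proj₂ (strictlySorted⇒punchIn w w-strict)
      on-r₀ : term w r₀ ≡ H (y ∘ punchIn r₀)
      on-r₀ = begin
        negPow (toℕ r₀) * seqSign (toℕ r₀ ∷ᶠ (toℕ ∘ w)) * H (y ∘ punchIn r₀)
          ≡⟨ cong (λ s → negPow (toℕ r₀) * s * H (y ∘ punchIn r₀))
               (trans (seqSign-cong (∷-cong (toℕ r₀) (cong toℕ ∘ w≗))) (seqSign-∷-punchIn r₀)) ⟩
        negPow (toℕ r₀) * negPow (toℕ r₀) * H (y ∘ punchIn r₀)
          ≡⟨ cong (_* H (y ∘ punchIn r₀)) (negPow-square (toℕ r₀)) ⟩
        1ℤ * H (y ∘ punchIn r₀)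
          ≡⟨ *-identityˡ _ ⟩
        H (y ∘ punchIn r₀) ∎
        where open ≡-Reasoning
      off-r₀ : ∀ r → r ≢ r₀ → term w r ≡ 0ℤ
      off-r₀ r r≢r₀ = term-zero {w} {r} (seqSign-∷-repeat (toℕ r) (toℕ ∘ w) (punchOut r₀≢r)
        (cong toℕ (trans (w≗ _) (punchIn-punchOut r₀≢r))))
        where
        r₀≢r : r₀ ≢ r
        r₀≢r = r≢r₀ ∘ sym

  Alternating-expansion : ∀ w → H (y ∘ w) ≡ sum (term w)
  Alternating-expansion = Alternating-sorted-unique (λ k w → H-alt k (y ∘ w)) expansion-alternating expansion-sorted

-- The alternating polynomials V n

swap-punchIn-inject₁ : ∀ {n} (k : Fin (suc n)) → swap k ∘ punchIn (inject₁ k) ≗ punchIn (suc k)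
swap-punchIn-inject₁ zero          zero    = refl
swap-punchIn-inject₁ zero          (suc t) = refl
swap-punchIn-inject₁ {suc n} (suc k) zero    = refl
swap-punchIn-inject₁ {suc n} (suc k) (suc t) = cong suc (swap-punchIn-inject₁ k t)

swap-punchIn-suc : ∀ {n} (k : Fin (suc n)) → swap k ∘ punchIn (suc k) ≗ punchIn (inject₁ k)
swap-punchIn-suc zero          zero    = refl
swap-punchIn-suc zero          (suc t) = refl
swap-punchIn-suc {suc n} (suc k) zero    = refl
swap-punchIn-suc {suc n} (suc k) (suc t) = cong suc (swap-punchIn-suc k t)

swap-punchIn : ∀ {n} (k : Fin (suc n)) r → r ≢ inject₁ k → r ≢ suc k →
  ∃ λ k′ → swap k ∘ punchIn r ≗ punchIn r ∘ swap k′
swap-punchIn zero          zero          r≢k _    = ⊥-elim (r≢k refl)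
swap-punchIn zero          (suc zero)    _   r≢k′ = ⊥-elim (r≢k′ refl)
swap-punchIn {suc n} zero    (suc (suc r)) _   _    =
  zero , λ { zero → refl ; (suc zero) → refl ; (suc (suc t)) → refl }
swap-punchIn {suc n} (suc k) zero          _   _    = k , λ t → refl
swap-punchIn {suc n} (suc k) (suc r)       r≢k r≢k′ with swap-punchIn k r (r≢k ∘ cong suc) (r≢k′ ∘ cong suc)
... | k′ , commute = suc k′ , λ { zero → refl ; (suc t) → cong suc (commute t) }

[]≔-punchIn-same : ∀ {A : Set} {n} (y : Fin (suc n) → A) r t → (y [ r ]≔ t) ∘ punchIn r ≗ y ∘ punchIn r
[]≔-punchIn-same y r t j = updateAt-minimal (punchIn r j) r y (punchInᵢ≢i r j)

[]≔-punchIn : ∀ {A : Set} {n} (y : Fin (suc n) → A) {r i} (r≢i : r ≢ i) t →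
  (y [ i ]≔ t) ∘ punchIn r ≗ (y ∘ punchIn r) [ punchOut r≢i ]≔ t
[]≔-punchIn y {r} {i} r≢i t j with punchIn r j FinP.≟ i
... | yes refl = trans (updateAt-updates (punchIn r j) y) (sym (trans
      (cong (λ u → ((y ∘ punchIn r) [ u ]≔ t) j) (sym (punchIn-injective r j _ (sym (punchIn-punchOut r≢i)))))
      (updateAt-updates j (y ∘ punchIn r))))
... | no  r≢ = trans (updateAt-minimal _ i y r≢) (sym (updateAt-minimal j (punchOut r≢i) (y ∘ punchIn r)
      (λ j≡ → r≢ (trans (cong (punchIn r) j≡) (punchIn-punchOut r≢i)))))

-- up to a constant factor, V n is the Vandermonde determinant of its n+1 arguments
V  : ∀ n → (Fin (suc n) → ℤ) → ℤ
∫V : ∀ n → (Fin (suc n) → ℤ) → ℤ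

V zero    y = 1ℤ
V (suc n) y = sum (λ r → negPow (toℕ r) * ∫V n (y ∘ punchIn r))

∫V n z = boxSum (suc n) zeros z (V n)

V-ext  : ∀ n → Extensional (V n)
∫V-ext : ∀ n → Extensional (∫V n)

V-ext zero    y≗z = refl
V-ext (suc n) y≗z = sum-cong-≗ (λ r → cong (negPow (toℕ r) *_) (∫V-ext n (y≗z ∘ punchIn r)))

∫V-ext n z≗z′ = boxSum-cong (suc n) {zeros} {zeros} (λ _ → refl) z≗z′ (V n)

V-alternating  : ∀ n → Alternating (V n)
∫V-alternating : ∀ n → Alternating (∫V n)

V-alternating (suc n) k y = begin
  sum (λ r → negPow (toℕ r) * ∫V n (y ∘ swap k ∘ punchIn r))  ≡⟨ sum-cong-≗ swapped ⟩
  sum (λ r → - ψ (swap k r))                                   ≡⟨ Linear.neg-hom sum-linear (ψ ∘ swap k) ⟩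
  - sum (ψ ∘ swap k)                                           ≡⟨ cong -_ (sum-swap k ψ) ⟩
  - sum ψ                                                      ∎
  where
  open ≡-Reasoning
  ψ : Fin (suc (suc n)) → ℤ
  ψ r = negPow (toℕ r) * ∫V n (y ∘ punchIn r)
  swapped : ∀ r → negPow (toℕ r) * ∫V n (y ∘ swap k ∘ punchIn r) ≡ - ψ (swap k r)
  swapped r with r FinP.≟ inject₁ k | r FinP.≟ suc k
  ... | yes refl | _ = begin
    negPow (toℕ (inject₁ k)) * ∫V n (y ∘ swap k ∘ punchIn (inject₁ k))
      ≡⟨ cong₂ _*_ (cong negPow (toℕ-inject₁ k)) (∫V-ext n (cong y ∘ swap-punchIn-inject₁ k)) ⟩
    negPow (toℕ k) * ∫V n (y ∘ punchIn (suc k))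
      ≡⟨ ℤP.neg-involutive _ ⟨
    - - (negPow (toℕ k) * ∫V n (y ∘ punchIn (suc k)))
      ≡⟨ cong -_ (ℤP.neg-distribˡ-* (negPow (toℕ k)) _) ⟩
    - (- negPow (toℕ k) * ∫V n (y ∘ punchIn (suc k)))
      ≡⟨ cong (λ a → - (a * ∫V n (y ∘ punchIn (suc k)))) (negPow-suc (toℕ k)) ⟨
    - ψ (suc k)
      ≡⟨ cong (-_ ∘ ψ) (swap-inject₁ k) ⟨
    - ψ (swap k (inject₁ k)) ∎
  ... | no _ | yes refl = begin
    negPow (suc (toℕ k)) * ∫V n (y ∘ swap k ∘ punchIn (suc k))
      ≡⟨ cong₂ _*_ (negPow-suc (toℕ k)) (∫V-ext n (cong y ∘ swap-punchIn-suc k)) ⟩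
    - negPow (toℕ k) * ∫V n (y ∘ punchIn (inject₁ k))
      ≡⟨ ℤP.neg-distribˡ-* (negPow (toℕ k)) _ ⟨
    - (negPow (toℕ k) * ∫V n (y ∘ punchIn (inject₁ k)))
      ≡⟨ cong (λ a → - (negPow a * ∫V n (y ∘ punchIn (inject₁ k)))) (toℕ-inject₁ k) ⟨
    - ψ (inject₁ k)
      ≡⟨ cong (-_ ∘ ψ) (swap-suc k) ⟨
    - ψ (swap k (suc k)) ∎
  ... | no r≢k | no r≢k′ = begin
    negPow (toℕ r) * ∫V n (y ∘ swap k ∘ punchIn r)
      ≡⟨ cong (negPow (toℕ r) *_) (∫V-ext n (cong y ∘ proj₂ (swap-punchIn k r r≢k r≢k′))) ⟩
    negPow (toℕ r) * ∫V n (y ∘ punchIn r ∘ swap (proj₁ (swap-punchIn k r r≢k r≢k′)))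
      ≡⟨ cong (negPow (toℕ r) *_) (∫V-alternating n _ (y ∘ punchIn r)) ⟩
    negPow (toℕ r) * - ∫V n (y ∘ punchIn r)
      ≡⟨ ℤP.neg-distribʳ-* (negPow (toℕ r)) _ ⟨
    - ψ r
      ≡⟨ cong (-_ ∘ ψ) (swap-other k r r≢k r≢k′) ⟨
    - ψ (swap k r) ∎

∫V-alternating n = boxSum-alternating n (V-ext n) (V-alternating n)

V-degree  : ∀ n → DegBelowEach (suc n) (V n)
∫V-degree : ∀ n → DegBelowEach (suc (suc n)) (∫V n)

V-degree zero    i y = DegBelow-const 0 1ℤ
V-degree (suc n) i y = DegBelow-linear (suc (suc n)) sum-linear _ λ r →
  DegBelow-* (suc (suc n)) (negPow (toℕ r)) (term r)
  where
  term : ∀ r → DegBelow (suc (suc n)) (λ t → ∫V n ((y [ i ]≔ t) ∘ punchIn r))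
  term r with r FinP.≟ i
  ... | yes refl = DegBelow-cong (suc (suc n)) (λ t → ∫V-ext n (sym ∘ []≔-punchIn-same y r t))
                     (DegBelow-const (suc n) (∫V n (y ∘ punchIn r)))
  ... | no r≢i   = DegBelow-cong (suc (suc n)) (λ t → ∫V-ext n (sym ∘ []≔-punchIn y r≢i t))
                     (∫V-degree n (punchOut r≢i) (y ∘ punchIn r))

∫V-degree n = boxSum-DegBelowEach (suc n) (suc n) (V-ext n) (V-degree n)

-- Trees

module TreeExpansion {m} (T : Tree (suc m)) where

  end : Fin (suc m) → Bool → Fin (suc (suc m))
  end j b = if b then proj₂ (edge T j) else proj₁ (edge T j)

  endpoint : (Fin (suc m) → Bool) → Fin (suc m) → Fin (suc (suc m))
  endpoint c j = end j (c j)

  coefficient : (Fin (suc m) → Bool) → Fin (suc (suc m)) → ℤ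
  coefficient c r = choiceSign c * seqSign (toℕ r ∷ᶠ (toℕ ∘ endpoint c))

  treeCoefficient : Fin (suc (suc m)) → ℤ
  treeCoefficient r = sumCube (suc m) (λ c → coefficient c r)

  private
    coefficient-ext : ∀ r → Extensional (λ c → coefficient c r)
    coefficient-ext r c≗c′ = cong₂ _*_ (choiceSign-cong c≗c′)
      (seqSign-cong (∷-cong (toℕ r) (λ t → cong (toℕ ∘ end t) (c≗c′ t))))

    coefficient-flip : ∀ j c → coefficient (updateAt c j not) (proj₂ (edge T j)) ≡ coefficient c (proj₁ (edge T j))
    coefficient-flip j c with c j in c-j
    ... | true = begin
      choiceSign c′ * seqSign (toℕ q ∷ᶠ (toℕ ∘ endpoint c′))
        ≡⟨ cong₂ _*_ (choiceSign-flip j c) (seqSign-cong (∷-cong (toℕ q) flipped)) ⟩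
      - choiceSign c * seqSign (toℕ q ∷ᶠ (v [ j ]≔ toℕ p))
        ≡⟨ cong (λ x → - choiceSign c * seqSign (toℕ (end j x) ∷ᶠ (v [ j ]≔ toℕ p))) c-j ⟨
      - choiceSign c * seqSign (v j ∷ᶠ (v [ j ]≔ toℕ p))
        ≡⟨ cong (- choiceSign c *_) (seqSign-∷-replace v j (toℕ p)) ⟩
      - choiceSign c * - seqSign (toℕ p ∷ᶠ v)
        ≡⟨ negate-both (choiceSign c) (seqSign (toℕ p ∷ᶠ v)) ⟩
      choiceSign c * seqSign (toℕ p ∷ᶠ v) ∎
      where
      open ≡-Reasoning
      p = proj₁ (edge T j)
      q = proj₂ (edge T j)
      c′ = updateAt c j not
      v = toℕ ∘ endpoint c
      negate-both : ∀ a b → - a * - b ≡ a * b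
      negate-both = solve-∀
      flipped : toℕ ∘ endpoint c′ ≗ v [ j ]≔ toℕ p
      flipped t with t FinP.≟ j
      ... | yes refl rewrite updateAt-updates t {not} c | c-j | updateAt-updates t {λ _ → toℕ p} v = refl
      ... | no t≢j = trans (cong (toℕ ∘ end t) (updateAt-minimal t j c t≢j)) (sym (updateAt-minimal t j v t≢j))
    ... | false = trans (cong (choiceSign c′ *_) q-repeated)
      (trans (*-zeroʳ (choiceSign c′)) (sym (trans (cong (choiceSign c *_) p-repeated) (*-zeroʳ (choiceSign c)))))
      where
      c′ = updateAt c j not
      q-repeated : seqSign (toℕ (proj₂ (edge T j)) ∷ᶠ (toℕ ∘ endpoint c′)) ≡ 0ℤ
      q-repeated = seqSign-∷-repeat _ (toℕ ∘ endpoint c′) j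
        (cong (toℕ ∘ end j) (trans (updateAt-updates j c) (cong not c-j)))
      p-repeated : seqSign (toℕ (proj₁ (edge T j)) ∷ᶠ (toℕ ∘ endpoint c)) ≡ 0ℤ
      p-repeated = seqSign-∷-repeat _ (toℕ ∘ endpoint c) j (cong (toℕ ∘ end j) c-j)

    treeCoefficient-edge : ∀ j → treeCoefficient (proj₂ (edge T j)) ≡ treeCoefficient (proj₁ (edge T j))
    treeCoefficient-edge j = trans (sumCube-flip (suc m) j (coefficient-ext (proj₂ (edge T j))))
                                   (sumCube-cong (suc m) (coefficient-flip j))

    treeCoefficient-constant : ∀ {v} → Conn (edge T) zero v → treeCoefficient v ≡ treeCoefficient zero
    treeCoefficient-constant here         = refl
    treeCoefficient-constant (fwd j path) = trans (treeCoefficient-edge j) (treeCoefficient-constant path)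
    treeCoefficient-constant (bwd j path) = trans (sym (treeCoefficient-edge j)) (treeCoefficient-constant path)

  tree-expansion : ∀ {H : (Fin (suc m) → ℤ) → ℤ} → Extensional H → Alternating H → ∀ y →
    sumCube (suc m) (λ c → choiceSign c * H (y ∘ endpoint c))
      ≡ treeCoefficient zero * sum (λ r → negPow (toℕ r) * H (y ∘ punchIn r))
  tree-expansion {H} H-ext H-alt y = begin
    sumCube (suc m) (λ c → choiceSign c * H (y ∘ endpoint c))
      ≡⟨ sumCube-cong (suc m) (λ c → cong (choiceSign c *_) (Alternating-expansion (endpoint c))) ⟩
    sumCube (suc m) (λ c → choiceSign c * sum (term (endpoint c)))
      ≡⟨ sumCube-cong (suc m) (λ c → *-distribˡ-sum (choiceSign c) (term (endpoint c))) ⟩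
    sumCube (suc m) (λ c → sum (λ r → choiceSign c * term (endpoint c) r))
      ≡⟨ Linear.sum-hom (sumCube-linear (suc m)) (λ r c → choiceSign c * term (endpoint c) r) ⟩
    sum (λ r → sumCube (suc m) (λ c → choiceSign c * term (endpoint c) r))
      ≡⟨ sum-cong-≗ (λ r → trans (sumCube-cong (suc m) (regroup r))
                                 (Linear.*-hom (sumCube-linear (suc m)) (X r) (λ c → coefficient c r))) ⟩
    sum (λ r → X r * treeCoefficient r)
      ≡⟨ sum-cong-≗ (λ r → trans (cong (X r *_) (treeCoefficient-constant (connected T r)))
                                 (ℤP.*-comm (X r) (treeCoefficient zero))) ⟩
    sum (λ r → treeCoefficient zero * X r)
      ≡⟨ *-distribˡ-sum (treeCoefficient zero) X ⟨
    treeCoefficient zero * sum X ∎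
    where
    open ≡-Reasoning
    open Expansion H-ext H-alt y
    X : Fin (suc (suc m)) → ℤ
    X r = negPow (toℕ r) * H (y ∘ punchIn r)
    rearrange : ∀ c a s h → c * (a * s * h) ≡ a * h * (c * s)
    rearrange = solve-∀
    regroup : ∀ r c → choiceSign c * term (endpoint c) r ≡ X r * coefficient c r
    regroup r c = rearrange (choiceSign c) (negPow (toℕ r)) (seqSign (toℕ r ∷ᶠ (toℕ ∘ endpoint c))) (H (y ∘ punchIn r))

sumℤ-++ : ∀ xs ys → sumℤ (xs ++ ys) ≡ sumℤ xs + sumℤ ys
sumℤ-++ []       ys = sym (+-identityˡ _)
sumℤ-++ (x ∷ xs) ys = trans (cong (x +_) (sumℤ-++ xs ys)) (sym (ℤP.+-assoc x _ _))

listSum-linear : ∀ {A : Set} (xs : List A) → Linear (λ f → sumℤ (map f xs))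
listSum-linear xs = record
  { cong-≗ = λ f≗g → cong sumℤ (ListP.map-cong f≗g xs)
  ; +-hom  = λ f g → +-hom f g xs
  ; *-hom  = λ x f → *-hom x f xs
  }
  where
  +-hom : ∀ {A : Set} (f g : A → ℤ) xs → sumℤ (map (λ a → f a + g a) xs) ≡ sumℤ (map f xs) + sumℤ (map g xs)
  +-hom f g []       = refl
  +-hom f g (x ∷ xs) = trans (cong (f x + g x +_) (+-hom f g xs)) (+-interchange (f x) (g x) _ _)
  *-hom : ∀ {A : Set} x (f : A → ℤ) xs → sumℤ (map (λ a → x * f a) xs) ≡ x * sumℤ (map f xs)
  *-hom x f []       = sym (*-zeroʳ x)
  *-hom x f (y ∷ xs) = trans (cong (x * f y +_) (*-hom x f xs)) (sym (ℤP.*-distribˡ-+ x (f y) _))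

sumℤ-map-∘ : ∀ {A B : Set} (f : B → ℤ) (g : A → B) xs → sumℤ (map f (map g xs)) ≡ sumℤ (map (f ∘ g) xs)
sumℤ-map-∘ f g xs = cong sumℤ (sym (ListP.map-∘ xs))

sumℤ-concatMap : ∀ {A B : Set} (f : B → ℤ) (h : A → List B) xs →
  sumℤ (map f (concatMap h xs)) ≡ sumℤ (map (λ x → sumℤ (map f (h x))) xs)
sumℤ-concatMap f h []       = refl
sumℤ-concatMap f h (x ∷ xs) = trans (cong sumℤ (ListP.map-++ f (h x) (concatMap h xs)))
  (trans (sumℤ-++ (map f (h x)) _) (cong (sumℤ (map f (h x)) +_) (sumℤ-concatMap f h xs)))

sumℤ-applyUpTo : ∀ φ N a (f : ℕ → ℤ) → (∀ t → f t ≡ φ (a + ℤ.+ t)) →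
  sumℤ (applyUpTo f N) ≡ defSum a (a + ℤ.+ N) φ
sumℤ-applyUpTo φ zero    a f f≗ =
  trans (sym (ℤP.+-inverseʳ (indefSum φ a))) (cong (λ u → indefSum φ u - indefSum φ a) (sym (+-identityʳ a)))
sumℤ-applyUpTo φ (suc N) a f f≗ = begin
  f 0 + sumℤ (applyUpTo (f ∘ suc) N)
    ≡⟨ cong₂ _+_ (trans (f≗ 0) (cong φ (+-identityʳ a)))
                 (sumℤ-applyUpTo φ N (1ℤ + a) (f ∘ suc) (λ t → trans (f≗ (suc t)) (cong φ (shift t)))) ⟩
  φ a + (indefSum φ (1ℤ + a + ℤ.+ N) - indefSum φ (1ℤ + a))
    ≡⟨ cong₂ (λ u v → φ a + (u - v)) (cong (indefSum φ) (sym (shift N))) (indefSum-suc φ a) ⟩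
  φ a + (indefSum φ (a + ℤ.+ suc N) - (indefSum φ a + φ a))
    ≡⟨ cancel (φ a) (indefSum φ (a + ℤ.+ suc N)) (indefSum φ a) ⟩
  indefSum φ (a + ℤ.+ suc N) - indefSum φ a ∎
  where
  open ≡-Reasoning
  reassoc : ∀ a t → a + (1ℤ + t) ≡ 1ℤ + a + t
  reassoc = solve-∀
  shift : ∀ t → a + ℤ.+ suc t ≡ 1ℤ + a + ℤ.+ t
  shift t = reassoc a (ℤ.+ t)
  cancel : ∀ x u v → x + (u - (v + x)) ≡ u - v
  cancel = solve-∀

rangeSum : ∀ φ {lo hi} → lo ℤ.≤ hi → sumℤ (map φ (range lo hi)) ≡ defSum lo hi φ
rangeSum φ {lo} {hi} lo≤hi = begin
  sumℤ (map φ (map (λ t → lo + ℤ.+ t) (upTo N)))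
    ≡⟨ sumℤ-map-∘ φ (λ t → lo + ℤ.+ t) (upTo N) ⟩
  sumℤ (map (λ t → φ (lo + ℤ.+ t)) (upTo N))
    ≡⟨ cong sumℤ (ListP.map-applyUpTo (λ t → t) (λ t → φ (lo + ℤ.+ t)) N) ⟩
  sumℤ (applyUpTo (λ t → φ (lo + ℤ.+ t)) N)
    ≡⟨ sumℤ-applyUpTo φ N lo _ (λ _ → refl) ⟩
  defSum lo (lo + ℤ.+ N) φ
    ≡⟨ cong (λ u → defSum lo u φ) lo+N≡hi ⟩
  defSum lo hi φ ∎
  where
  open ≡-Reasoning
  N = span (hi - lo)
  span-nonneg : ∀ d → 0ℤ ℤ.≤ d → ℤ.+ span d ≡ d
  span-nonneg (ℤ.+ n) _ = refl
  cancel : ∀ a b → a + (b - a) ≡ b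
  cancel = solve-∀
  lo+N≡hi : lo + ℤ.+ N ≡ hi
  lo+N≡hi = trans (cong (lo +_) (span-nonneg (hi - lo) (ℤP.i≤j⇒0≤j-i lo≤hi))) (cancel lo hi)

orientation-sum-range : ∀ φ a b c →
  orientation a b * sumℤ (map (λ x → φ (x + c)) (range ((a ⊓ b) - c) ((a ⊔ b) - c))) ≡ defSum a b φ
orientation-sum-range φ a b c = begin
  orientation a b * sumℤ (map (λ x → φ (x + c)) (range ((a ⊓ b) - c) ((a ⊔ b) - c)))
    ≡⟨ cong (orientation a b *_) (rangeSum (λ x → φ (x + c)) (ℤP.+-monoˡ-≤ (- c) (ℤP.i⊓j≤i⊔j a b))) ⟩
  orientation a b * defSum ((a ⊓ b) - c) ((a ⊔ b) - c) (λ x → φ (x + c))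
    ≡⟨ cong (orientation a b *_) (trans (defSum-shift φ c ((a ⊓ b) - c) ((a ⊔ b) - c))
                                         (cong₂ (λ u v → defSum u v φ) (cancel (a ⊓ b) c) (cancel (a ⊔ b) c))) ⟩
  orientation a b * defSum (a ⊓ b) (a ⊔ b) φ
    ≡⟨ orientation-defSum a b φ ⟩
  defSum a b φ ∎
  where
  open ≡-Reasoning
  cancel : ∀ x c → x - c + c ≡ x
  cancel = solve-∀

orientation-sum-box : ∀ m (a b c : Fin m → ℤ) {g} → Extensional g →
  ∏ (λ j → orientation (a j) (b j))
    * sumℤ (map (λ l → g (λ j → l j + c j)) (box m (λ j → (a j ⊓ b j) - c j) (λ j → (a j ⊔ b j) - c j)))
    ≡ boxSum m a b g
orientation-sum-box zero    a b c g-ext = trans (*-identityˡ _) (trans (+-identityʳ _) (g-ext λ ()))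
orientation-sum-box (suc m) a b c {g} g-ext = begin
  (s₀ * Π) * sumℤ (map G (concatMap (λ x → map (x ∷ᶠ_) inner) outer))
    ≡⟨ cong ((s₀ * Π) *_) (sumℤ-concatMap G (λ x → map (x ∷ᶠ_) inner) outer) ⟩
  (s₀ * Π) * sumℤ (map (λ x → sumℤ (map G (map (x ∷ᶠ_) inner))) outer)
    ≡⟨ cong ((s₀ * Π) *_) (Outer.cong-≗ (λ x → trans (sumℤ-map-∘ G (x ∷ᶠ_) inner)
                                                     (Linear.cong-≗ (listSum-linear inner) (λ l → g-ext (shifted x l))))) ⟩
  (s₀ * Π) * sumℤ (map Ψ outer)
    ≡⟨ ℤP.*-assoc s₀ Π _ ⟩
  s₀ * (Π * sumℤ (map Ψ outer))
    ≡⟨ cong (s₀ *_) (sym (Outer.*-hom Π Ψ)) ⟩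
  s₀ * sumℤ (map (λ x → Π * Ψ x) outer)
    ≡⟨ cong (s₀ *_) (Outer.cong-≗ (λ x →
         orientation-sum-box m (tail a) (tail b) (tail c) (g-ext ∘ ∷-cong (x + c zero)))) ⟩
  s₀ * sumℤ (map (λ x → Φ (x + c zero)) outer)
    ≡⟨ orientation-sum-range Φ (a zero) (b zero) (c zero) ⟩
  defSum (a zero) (b zero) Φ ∎
  where
  open ≡-Reasoning
  s₀ = orientation (a zero) (b zero)
  Π = ∏ (λ j → orientation (a (suc j)) (b (suc j)))
  inner = box m (λ j → (a (suc j) ⊓ b (suc j)) - c (suc j)) (λ j → (a (suc j) ⊔ b (suc j)) - c (suc j))
  outer = range ((a zero ⊓ b zero) - c zero) ((a zero ⊔ b zero) - c zero)
  module Outer = Linear (listSum-linear outer)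
  G : (Fin (suc m) → ℤ) → ℤ
  G l = g (λ j → l j + c j)
  Ψ : ℤ → ℤ
  Ψ x = sumℤ (map (λ l → g ((x + c zero) ∷ᶠ (λ j → l j + c (suc j)))) inner)
  Φ : ℤ → ℤ
  Φ x = boxSum m (tail a) (tail b) (g ∘ (x ∷ᶠ_))
  shifted : ∀ x l → (λ j → (x ∷ᶠ l) j + c j) ≗ ((x + c zero) ∷ᶠ (λ j → l j + c (suc j)))
  shifted x l zero    = refl
  shifted x l (suc j) = refl

-- L as a multiple of V

occurrences : ∀ {A : Set} → (A → Bool) → List A → ℕ
occurrences p = List.foldr (λ x acc → if p x then suc acc else acc) 0

negPow-occurrences : ∀ {A : Set} {m} (f : Fin m → A) (p : A → Bool) →
  negPow (occurrences p (List.tabulate f)) ≡ ∏ (λ j → if p (f j) then -1ℤ else 1ℤ)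
negPow-occurrences {m = zero}  f p = refl
negPow-occurrences {m = suc m} f p with p (f zero)
... | true  = trans (negPow-suc (occurrences p (List.tabulate (f ∘ suc))))
                    (trans (cong -_ (negPow-occurrences (f ∘ suc) p)) (sym (-1*i≡-i _)))
... | false = trans (negPow-occurrences (f ∘ suc) p) (sym (*-identityˡ _))

negPow-invCount : ∀ {m} (T : Tree m) k →
  negPow (invCount T k) ≡ ∏ (λ j → orientation (vval k (proj₁ (edge T j))) (vval k (proj₂ (edge T j))))
negPow-invCount {m} T k = trans
  (negPow-occurrences (λ j → j) (λ j → if does (vval k (proj₁ (edge T j)) ℤ.<? vval k (proj₂ (edge T j)))
                                       then false else true))
  (Product.sum-cong-≗ (λ j → if-not (does (vval k (proj₁ (edge T j)) ℤ.<? vval k (proj₂ (edge T j))))))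
  where
  if-not : ∀ b → (if (if b then false else true) then -1ℤ else 1ℤ) ≡ (if b then 1ℤ else -1ℤ)
  if-not true  = refl
  if-not false = refl

range-bounds : ∀ lo hi → All (λ x → lo ℤ.≤ x × x ℤ.< hi) (range lo hi)
range-bounds lo hi with hi - lo in eq
... | ℤ.+ N = AllP.map⁺ (AllP.applyUpTo⁺₁ (λ t → t) N λ {t} t<N →
  ℤP.i≤i+j lo (ℤ.+ t) , subst (lo + ℤ.+ t ℤ.<_) lo+N≡hi (ℤP.+-monoʳ-< lo (ℤ.+<+ t<N)))
  where
  cancel : ∀ l h → l + (h - l) ≡ h
  cancel = solve-∀
  lo+N≡hi : lo + ℤ.+ N ≡ hi
  lo+N≡hi = trans (cong (lo +_) (sym eq)) (cancel lo hi)
... | -[1+ _ ] = []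

box-bounds : ∀ m (lo hi : Fin m → ℤ) → All (λ l → ∀ j → lo j ℤ.≤ l j × l j ℤ.< hi j) (box m lo hi)
box-bounds zero    lo hi = (λ ()) ∷ []
box-bounds (suc m) lo hi = AllP.concat⁺ (AllP.map⁺ (All.map
  (λ x-bounds → AllP.map⁺ (All.map (λ l-bounds → λ { zero → x-bounds ; (suc j) → l-bounds j })
                                   (box-bounds m (tail lo) (tail hi))))
  (range-bounds (lo zero) (hi zero))))

between⇒EdgeAdm : ∀ a b c l → (a ⊓ b) - c ℤ.≤ l → l ℤ.< (a ⊔ b) - c →
  (a ℤ.< b → (a ℤ.≤ l + c × l + c ℤ.< b)) × (¬ (a ℤ.< b) → (b ℤ.≤ l + c × l + c ℤ.< a))
between⇒EdgeAdm a b c l lo≤l l<hi =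
  (λ a<b → subst (ℤ._≤ l + c) (ℤP.i≤j⇒i⊓j≡i (ℤP.<⇒≤ a<b)) min≤ ,
           subst (l + c ℤ.<_) (ℤP.i≤j⇒i⊔j≡j (ℤP.<⇒≤ a<b)) <max) ,
  (λ a≮b → subst (ℤ._≤ l + c) (ℤP.i≥j⇒i⊓j≡j (ℤP.≮⇒≥ a≮b)) min≤ ,
           subst (l + c ℤ.<_) (ℤP.i≥j⇒i⊔j≡i (ℤP.≮⇒≥ a≮b)) <max)
  where
  cancel : ∀ x c → x - c + c ≡ x
  cancel = solve-∀
  min≤ : a ⊓ b ℤ.≤ l + c
  min≤ = subst (ℤ._≤ l + c) (cancel (a ⊓ b) c) (ℤP.+-monoˡ-≤ c lo≤l)
  <max : l + c ℤ.< a ⊔ b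
  <max = subst (l + c ℤ.<_) (cancel (a ⊔ b) c) (ℤP.+-monoˡ-< c l<hi)

admissibles≡candidates : ∀ {m} (T : Tree m) k → admissibles T k ≡ candidates T k
admissibles≡candidates {m} T k = ListP.filter-all (admissible? T k)
  (All.map (λ l-bounds j → between⇒EdgeAdm _ _ _ _ (proj₁ (l-bounds j)) (proj₂ (l-bounds j))) (box-bounds m _ _))

Lpoly-suc : ∀ n (ts : TreeSeq (suc n)) (T : Tree (suc n)) k →
  Lpoly (suc n) (ts , T) k ≡ sgnTree T * (negPow (invCount T k) * sumℤ (map (Lpoly n ts) (admissibles T k)))
Lpoly-suc n ts T k = begin
  sumℤ (map (sgnGT (suc (suc n)) (ts , T)) (map (_, k) (concatMap (gtSeqs n ts) (admissibles T k))))
    ≡⟨ sumℤ-map-∘ (sgnGT (suc (suc n)) (ts , T)) (_, k) (concatMap (gtSeqs n ts) (admissibles T k)) ⟩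
  sumℤ (map (λ s → sgnGT (suc (suc n)) (ts , T) (s , k)) (concatMap (gtSeqs n ts) (admissibles T k)))
    ≡⟨ sumℤ-concatMap (λ s → sgnGT (suc (suc n)) (ts , T) (s , k)) (gtSeqs n ts) (admissibles T k) ⟩
  sumℤ (map (λ l → sumℤ (map (λ s → sgnGT (suc (suc n)) (ts , T) (s , k)) (gtSeqs n ts l))) (admissibles T k))
    ≡⟨ Linear.cong-≗ (listSum-linear (admissibles T k)) (λ l →
         trans (Linear.cong-≗ (listSum-linear (gtSeqs n ts l)) sgn-split)
               (Linear.*-hom (listSum-linear (gtSeqs n ts l)) C (sgnGT (suc n) ts))) ⟩
  sumℤ (map (λ l → C * Lpoly n ts l) (admissibles T k))
    ≡⟨ Linear.*-hom (listSum-linear (admissibles T k)) C (Lpoly n ts) ⟩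
  C * sumℤ (map (Lpoly n ts) (admissibles T k))
    ≡⟨ ℤP.*-assoc (sgnTree T) _ _ ⟩
  sgnTree T * (negPow (invCount T k) * sumℤ (map (Lpoly n ts) (admissibles T k))) ∎
  where
  open ≡-Reasoning
  C = sgnTree T * negPow (invCount T k)
  regroup : ∀ a b s t → a * b * (s * t) ≡ t * b * (a * s)
  regroup = solve-∀
  sgn-split : ∀ s → sgnGT (suc (suc n)) (ts , T) (s , k) ≡ C * sgnGT (suc n) ts s
  sgn-split s = trans (cong (_* (sgnTS (suc n) ts * sgnTree T)) (negPow-+ (invSeq (suc n) ts s) (invCount T k)))
                      (regroup (negPow (invSeq (suc n) ts s)) (negPow (invCount T k)) (sgnTS (suc n) ts) (sgnTree T))

Lpoly-∝-V : ∀ n (𝒯 : TreeSeq (suc n)) → ∃ λ β → ∀ k → Lpoly n 𝒯 k ≡ β * V n (vval k)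
Lpoly-∝-V zero    (_ , T)  = sgnTree T , λ k → simplify (sgnTree T)
  where
  simplify : ∀ s → 1ℤ * (1ℤ * s) + 0ℤ ≡ s * 1ℤ
  simplify = solve-∀
Lpoly-∝-V (suc n) (ts , T) = sgnTree T * β * treeCoefficient zero , proportional
  where
  open TreeExpansion T
  β = proj₁ (Lpoly-∝-V n ts)
  Lpoly≡ = proj₂ (Lpoly-∝-V n ts)
  regroup : ∀ s n b x → s * (n * (b * x)) ≡ s * b * (n * x)
  regroup = solve-∀
  proportional : ∀ k → Lpoly (suc n) (ts , T) k ≡ sgnTree T * β * treeCoefficient zero * V (suc n) (vval k)
  proportional k = begin
    Lpoly (suc n) (ts , T) k
      ≡⟨ Lpoly-suc n ts T k ⟩
    sgnTree T * (negPow (invCount T k) * sumℤ (map (Lpoly n ts) (admissibles T k)))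
      ≡⟨ cong (λ u → sgnTree T * (negPow (invCount T k) * u)) (trans
           (cong (λ ls → sumℤ (map (Lpoly n ts) ls)) (admissibles≡candidates T k))
           (trans (Linear.cong-≗ (listSum-linear (candidates T k)) Lpoly≡)
                  (Linear.*-hom (listSum-linear (candidates T k)) β (V n ∘ vval)))) ⟩
    sgnTree T * (negPow (invCount T k) * (β * sumℤ (map (V n ∘ vval) (candidates T k))))
      ≡⟨ regroup (sgnTree T) (negPow (invCount T k)) β _ ⟩
    sgnTree T * β * (negPow (invCount T k) * sumℤ (map (V n ∘ vval) (candidates T k)))
      ≡⟨ cong (λ s → sgnTree T * β * (s * sumℤ (map (V n ∘ vval) (candidates T k)))) (negPow-invCount T k) ⟩
    sgnTree T * β * (∏ (λ j → orientation (a j) (b j)) * sumℤ (map (V n ∘ vval) (candidates T k)))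
      ≡⟨ cong (sgnTree T * β *_) (orientation-sum-box (suc n) a b (λ j → ℤ.+ suc (toℕ j)) (V-ext n)) ⟩
    sgnTree T * β * boxSum (suc n) a b (V n)
      ≡⟨ cong (sgnTree T * β *_) (boxSum-inclusion-exclusion (suc n) a b (V n)) ⟩
    sgnTree T * β * sumCube (suc n) (λ c → choiceSign c * boxSum (suc n) zeros (choose c a b) (V n))
      ≡⟨ cong (sgnTree T * β *_) (sumCube-cong (suc n) (λ c → cong (choiceSign c *_) (∫V-ext n (chosen c)))) ⟩
    sgnTree T * β * sumCube (suc n) (λ c → choiceSign c * ∫V n (y ∘ endpoint c))
      ≡⟨ cong (sgnTree T * β *_) (tree-expansion (∫V-ext n) (∫V-alternating n) y) ⟩
    sgnTree T * β * (treeCoefficient zero * V (suc n) y)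
      ≡⟨ ℤP.*-assoc (sgnTree T * β) _ _ ⟨
    sgnTree T * β * treeCoefficient zero * V (suc n) (vval k) ∎
    where
    open ≡-Reasoning
    y = vval k
    a b : Fin (suc n) → ℤ
    a j = y (proj₁ (edge T j))
    b j = y (proj₂ (edge T j))
    chosen : ∀ c → choose c a b ≗ y ∘ endpoint c
    chosen c j with c j
    ... | true  = refl
    ... | false = refl

Δ^-cong : ∀ r {N} i {F G : (Fin N → ℤ) → ℤ} → (∀ k → F k ≡ G k) → ∀ k → Δ^ r i F k ≡ Δ^ r i G k
Δ^-cong zero    i F≗G k = F≗G k
Δ^-cong (suc r) i F≗G k = cong₂ _-_ (Δ^-cong r i F≗G _) (Δ^-cong r i F≗G k)

Δ^≡δ^ : ∀ r {N} {G : (Fin N → ℤ) → ℤ} → Extensional G →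
  ∀ i k → Δ^ r i G k ≡ δ^ r (λ t → G (k [ i ]≔ t)) (k i)
Δ^≡δ^ zero    G-ext i k = G-ext (sym ∘ updateAt-id-local i k refl)
Δ^≡δ^ (suc r) {G = G} G-ext i k = cong₂ _-_
  (trans (Δ^≡δ^ r G-ext i k′) (trans (δ^-cong r (λ t → G-ext (updateAt-updateAt i k)) (k′ i))
                                        (cong (δ^ r (λ t → G (k [ i ]≔ t))) (updateAt-updates i k))))
  (Δ^≡δ^ r G-ext i k)
  where
  k′ = updateAt k i (_+ 1ℤ)

DegBelowEach⇒Δ^≡0 : ∀ d {N} {G : (Fin N → ℤ) → ℤ} → Extensional G → DegBelowEach d G →
  ∀ i k → Δ^ d i G k ≡ 0ℤ
DegBelowEach⇒Δ^≡0 d G-ext G-deg i k = trans (Δ^≡δ^ d G-ext i k) (G-deg i k (k i))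

vval-[]≔ : ∀ {n} (k : Fin (suc n) → ℤ) i t → vval (k [ i ]≔ t) ≗ vval k [ i ]≔ (t + ℤ.+ suc (toℕ i))
vval-[]≔ k i t j with j FinP.≟ i
... | yes refl = trans (cong (_+ ℤ.+ suc (toℕ j)) (updateAt-updates j k)) (sym (updateAt-updates j (vval k)))
... | no j≢i   = trans (cong (_+ ℤ.+ suc (toℕ j)) (updateAt-minimal j i k j≢i))
                       (sym (updateAt-minimal j i (vval k) j≢i))

scaledV-degree : ∀ n β → DegBelowEach (suc n) (λ k → β * V n (vval k))
scaledV-degree n β i k = DegBelow-cong (suc n) (λ t → cong (β *_) (V-ext n (sym ∘ vval-[]≔ k i t)))
  (DegBelow-* (suc n) β (DegBelow-shift (suc n) (ℤ.+ suc (toℕ i)) (V-degree n i (vval k))))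

lemma3 : (n : ℕ) (𝒯 : TreeSeq (suc n)) (i : Fin (suc n)) (k : Fin (suc n) → ℤ) →
    Δ^ (suc n) i (Lpoly n 𝒯) k ≡ 0ℤ
lemma3 n 𝒯 i k = trans (Δ^-cong (suc n) i L≡βV k)
  (DegBelowEach⇒Δ^≡0 (suc n) (cong (β *_) ∘ V-ext n ∘ vval-cong) (scaledV-degree n β) i k)
  where
  β = proj₁ (Lpoly-∝-V n 𝒯)
  L≡βV = proj₂ (Lpoly-∝-V n 𝒯)
  vval-cong : ∀ {k k′ : Fin (suc n) → ℤ} → k ≗ k′ → vval k ≗ vval k′
  vval-cong k≗k′ j = cong (_+ ℤ.+ suc (toℕ j)) (k≗k′ j)
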